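{- Let $M$ be a matroid and let $k$ be its contraction$^*$-depth. If some element of $M$ is neither a loop nor a coloop, or all elements of $M$ are loops, then $k\le \mathrm{c^*d}(M)-1$, where $\mathrm{c^*d}$ denotes c$^*$-depth.
   Context: A contraction$^*$-depth decomposition of $M$ is a pair $(T,f)$ with $T$ a rooted tree and $f$ a map from $E(M)$ to the leaves of $T$ such that $|E(T)|=r(M)$ and, for every $X\subseteq E(M)$, $r_M(X)\le |E(T_X)|$, where $T_X$ is the union of all paths from the root to the leaves $f(x)$, $x\in X$. The height of a rooted tree is the number of vertices on its longest root-to-leaf path. The contraction$^*$-depth of $M$ is the minimum of $\mathrm{height}(T)-1$ over all such decompositions. A component of a matroid is an inclusion-wise maximal set of elements any two of which lie in a common circuit; $M$ is connected if it has one component. $M'$ is a c$^*$-transformation of $M$ if there are a matroid $M^+$ and $e\in E(M^+)$ with $M=M^+\setminus e$ and $M'=M^+/e$. The c$^*$-depth $\mathrm{c^*d}(M)$ is: $1$ if $|E(M)|\le1$; the maximum over the restrictions of $M$ to its components if $M$ is not connected; and $1+\min\{\mathrm{c^*d}(M'): M'\ne M\text{ a c}^*\text{ -transformation of }M\}$ if $M$ is connected. -}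

module Defs where

open import Data.Nat using (ℕ; zero; suc; _+_; _∸_; _≤_; _<_)
open import Data.Bool using (if_then_else_)
open import Data.Fin using (Fin; zero; suc; toℕ)
open import Data.Fin.Subset using (Subset; ⊤; ⊥; ⁅_⁆; _∈_; _⊆_; _⊂_; _∪_; _∩_; _-_; ∣_∣; inside; outside)
open import Data.Vec using (Vec; []; _∷_; tail)
open import Data.Product using (Σ; ∃; _×_)
open import Relation.Binary.PropositionalEquality using (_≡_; _≢_)
open import Relation.Nullary using (¬_)

-- Matroids on the ground set Fin n, given by their rank function
-- (rank axioms R1–R3).  The ground set E(M) is ⊤.

record Matroid (n : ℕ) : Set where
  field
    rank      : Subset n → ℕ
    rank-≤    : ∀ X → rank X ≤ ∣ X ∣
    rank-mono : ∀ X Y → X ⊆ Y → rank X ≤ rank Y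
    rank-sub  : ∀ X Y → rank (X ∪ Y) + rank (X ∩ Y) ≤ rank X + rank Y

open Matroid public

module _ {n : ℕ} (M : Matroid n) where

  Independent : Subset n → Set
  Independent X = rank M X ≡ ∣ X ∣

  Circuit : Subset n → Set
  Circuit C = ¬ Independent C × (∀ Y → Y ⊂ C → Independent Y)

  Loop : Fin n → Set
  Loop x = rank M ⁅ x ⁆ ≡ 0

  Coloop : Fin n → Set
  Coloop x = rank M (⊤ - x) < rank M ⊤

  Linked : Subset n → Set
  Linked S = ∀ x y → x ∈ S → y ∈ S → x ≢ y →
             ∃ λ C → Circuit C × x ∈ C × y ∈ C

  IsComponent : Subset n → Set
  IsComponent S = Linked S × (∀ T → S ⊆ T → Linked T → T ⊆ S)

  Connected : Set
  Connected = ∃ λ S → IsComponent S × (∀ T → IsComponent T → T ≡ S)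

SameMatroid : ∀ {n} → Matroid n → Matroid n → Set
SameMatroid M M' = ∀ X → rank M X ≡ rank M' X

-- M' is a c*-transformation of M: there is M⁺ on Fin (suc n) whose
-- extra element e = zero satisfies M = M⁺ \ e and M' = M⁺ / e.
CStarTransformation : ∀ {n} → Matroid n → Matroid n → Set
CStarTransformation {n} M M' =
  Σ (Matroid (suc n)) λ M⁺ →
    (∀ X → rank M X ≡ rank M⁺ (outside ∷ X)) ×
    (∀ X → rank M' X ≡ rank M⁺ (inside ∷ X) ∸ rank M⁺ ⁅ zero ⁆)

-- N (on Fin k) is the restriction M|S, transported along the
-- bijection g : Fin k → S.
IsRestrictionVia : ∀ {n k} → Matroid n → Subset n → Matroid k → (Fin k → Fin n) → Set
IsRestrictionVia {n} {k} M S N g =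
  (∀ i j → g i ≡ g j → i ≡ j) ×
  (∀ y → y ∈ S → ∃ λ i → g i ≡ y) ×
  (∀ i → g i ∈ S) ×
  (∀ X Y → (∀ y → y ∈ Y → ∃ λ i → i ∈ X × g i ≡ y) →
           (∀ i → i ∈ X → g i ∈ Y) →
           rank N X ≡ rank M Y)

-- CStarDepthAtMost M m  means  c*d(M) ≤ m, following the recursive
-- definition of c*-depth (least fixed point).
data CStarDepthAtMost : {n : ℕ} → Matroid n → ℕ → Set where
  small      : ∀ {n m} (M : Matroid n) → n ≤ 1 → 1 ≤ m → CStarDepthAtMost M m
  disconnected : ∀ {n m} (M : Matroid n) → 2 ≤ n → ¬ Connected M →
    (∀ S → IsComponent M S → ∀ k (N : Matroid k) (g : Fin k → Fin n) →
       IsRestrictionVia M S N g → CStarDepthAtMost N m) →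
    CStarDepthAtMost M m
  connected  : ∀ {n m} (M : Matroid n) → 2 ≤ n → Connected M →
    (M' : Matroid n) → CStarTransformation M M' → ¬ SameMatroid M M' →
    CStarDepthAtMost M' m → CStarDepthAtMost M (suc m)

-- Rooted trees: vertices Fin (suc edges), root = zero, the vertex suc i
-- has parent  parent i  with a smaller index.  |E(T)| = edges.

record RootedTree : Set where
  field
    edges    : ℕ
    parent   : Fin edges → Fin (suc edges)
    parent-< : ∀ i → toℕ (parent i) ≤ toℕ i

open RootedTree public

module _ (T : RootedTree) where

  ancestorsUpTo : ℕ → Fin (suc (edges T)) → Subset (suc (edges T))
  ancestorsUpTo zero    v       = ⁅ v ⁆
  ancestorsUpTo (suc k) zero    = ⁅ zero ⁆
  ancestorsUpTo (suc k) (suc i) = ⁅ suc i ⁆ ∪ ancestorsUpTo k (parent T i)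

  -- vertex set of the root-to-v path (edges T steps always suffice)
  rootPath : Fin (suc (edges T)) → Subset (suc (edges T))
  rootPath = ancestorsUpTo (edges T)

  IsLeaf : Fin (suc (edges T)) → Set
  IsLeaf v = ∀ i → parent T i ≢ v

  -- height(T) ≤ h : every root-to-leaf path has at most h vertices
  HeightAtMost : ℕ → Set
  HeightAtMost h = ∀ v → IsLeaf v → ∣ rootPath v ∣ ≤ h

unionOver : ∀ {n k} → Subset n → (Fin n → Subset k) → Subset k
unionOver {zero}  []      g = ⊥
unionOver {suc n} (b ∷ X) g = (if b then g zero else ⊥) ∪ unionOver X (λ x → g (suc x))

-- |E(T_X)|: T_X = union of the root paths of f(x), x ∈ X; its edges
-- correspond to its non-root vertices.
edgesOfUnionOfPaths : ∀ {n} (T : RootedTree) → (Fin n → Fin (suc (edges T))) → Subset n → ℕ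
edgesOfUnionOfPaths T f X = ∣ tail (unionOver X (λ x → rootPath T (f x))) ∣

record Decomposition {n : ℕ} (M : Matroid n) : Set where
  field
    tree       : RootedTree
    leafMap    : Fin n → Fin (suc (edges tree))
    leafMap-leaf : ∀ x → IsLeaf tree (leafMap x)
    edges≡rank : edges tree ≡ rank M ⊤
    rank-bound : ∀ X → rank M X ≤ edgesOfUnionOfPaths tree leafMap X

open Decomposition public

-- contraction*-depth(M) ≤ k  iff  some decomposition has height ≤ k + 1
ContractionStarDepthAtMost : ∀ {n} → Matroid n → ℕ → Set
ContractionStarDepthAtMost M k = ∃ λ (D : Decomposition M) → HeightAtMost (tree D) (suc k)

-- Induction on the derivation of c*d(M) ≤ d, producing a contraction*-depth
-- decomposition of height ≤ d.  With at most one element the hypothesis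
-- forces rank 0, and the one-vertex tree works.  If M is connected and
-- M′ = M⁺ / e ≠ M = M⁺ ∖ e, then e is neither a loop nor a coloop of M⁺, so
-- r(M) = r(M′) + 1 and r_M(X) ≤ r_M′(X) + 1; every element of M lies in a
-- circuit, hence is not a coloop of M′, so M′ satisfies the hypothesis again
-- and a new root edge above a decomposition of M′ serves for M.  If M is
-- disconnected, rank is additive over components, and decompositions of the
-- components are glued at their roots: a component with two or more
-- elements satisfies the hypothesis, and a coloop component needs height 2,
-- which c*d(M) ≥ 2 provides since M has an element in a circuit of size ≥ 2.
-- Components exist because "lying in a common circuit" is transitive, by
-- strong circuit elimination.

module Submission where

open import Defs
open import Data.Bool using (if_then_else_)
open import Data.Fin using (Fin; zero; suc; toℕ; fromℕ; fromℕ<; _↑ˡ_; _↑ʳ_; splitAt)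
open import Data.Fin.Properties as Finₚ using (any?) renaming (_≟_ to _≟ᶠ_)
open import Data.Fin.Subset
open import Data.Fin.Subset.Properties
open import Data.Fin.Subset.Induction using (⊂-wellFounded)
open import Data.Nat using (ℕ; zero; suc; _+_; _∸_; _≤_; _<_; z≤n; s≤s)
open import Data.Nat.Properties
open import Data.Product using (∃; _×_; _,_; proj₁; proj₂; map₂)
open import Data.Sum using (_⊎_; inj₁; inj₂; [_,_]′)
open import Data.Vec using ([]; _∷_; tail; here; there; _++_)
open import Data.Vec.Properties using (zipWith-++)
open import Function using (_∘_)
open import Induction.WellFounded using (module All)
open import Level using (0ℓ)
open import Relation.Binary.PropositionalEquality
open import Relation.Nullary

private variable
  n : ℕ

-- Subsets of Fin n

⊂-rec : (P : Subset n → Set) → (∀ X → (∀ {Y} → Y ⊂ X → P Y) → P X) → ∀ X → P X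
⊂-rec = All.wfRec ⊂-wellFounded 0ℓ

x∈p─q⁻ : ∀ {x : Fin n} p q → x ∈ p ─ q → x ∈ p × x ∉ q
x∈p─q⁻ (inside ∷ p) (outside ∷ q) here = here , λ ()
x∈p─q⁻ {x = zero} (outside ∷ p) (inside ∷ q) ()
x∈p─q⁻ {x = zero} (outside ∷ p) (outside ∷ q) ()
x∈p─q⁻ (s ∷ p) (t ∷ q) (there x∈) = let (x∈p , x∉q) = x∈p─q⁻ p q x∈ in there x∈p , x∉q ∘ drop-there

x∈p-y⁻ : ∀ {x : Fin n} p y → x ∈ p - y → x ∈ p × x ≢ y
x∈p-y⁻ p y x∈ = map₂ x∉⁅y⁆⇒x≢y (x∈p─q⁻ p ⁅ y ⁆ x∈)

another-element : 2 ≤ n → ∀ (x : Fin n) → ∃ λ y → y ≢ x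
another-element (s≤s (s≤s _)) zero    = suc zero , λ ()
another-element (s≤s (s≤s _)) (suc _) = zero , λ ()

Fin≤1-unique : n ≤ 1 → (x y : Fin n) → x ≡ y
Fin≤1-unique (s≤s z≤n) zero zero = refl

∪-least : ∀ {p q r : Subset n} → p ⊆ r → q ⊆ r → p ∪ q ⊆ r
∪-least {p = p} {q} p⊆r q⊆r x∈ = [ p⊆r , q⊆r ]′ (x∈p∪q⁻ p q x∈)

x∈p∪q∧x∉p⇒x∈q : ∀ {x : Fin n} {p q} → x ∈ p ∪ q → x ∉ p → x ∈ q
x∈p∪q∧x∉p⇒x∈q {p = p} {q} x∈p∪q x∉p = [ (λ x∈p → contradiction x∈p x∉p) , (λ x∈q → x∈q) ]′ (x∈p∪q⁻ p q x∈p∪q)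

⁅x⁆⊆p : ∀ {x : Fin n} {p} → x ∈ p → ⁅ x ⁆ ⊆ p
⁅x⁆⊆p {x = x} {p} x∈p y∈⁅x⁆ = subst (_∈ p) (sym (x∈⁅y⁆⇒x≡y x y∈⁅x⁆)) x∈p

p-x⊆p : ∀ (p : Subset n) x → p - x ⊆ p
p-x⊆p p x = p─q⊆p p ⁅ x ⁆

x∉p-x : ∀ (p : Subset n) x → x ∉ p - x
x∉p-x p x x∈ = proj₂ (x∈p-y⁻ p x x∈) refl

p⊆p-x∪q : ∀ {x : Fin n} p {q} → x ∈ q → p ⊆ (p - x) ∪ q
p⊆p-x∪q {x = x} p x∈q {y} y∈p with y ≟ᶠ x
... | yes refl = q⊆p∪q (p - x) _ x∈q
... | no y≢x = p⊆p∪q _ (x∈p∧x≢y⇒x∈p-y y∈p y≢x)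

p⊆p∩q∪p─q : ∀ (p q : Subset n) → p ⊆ (p ∩ q) ∪ (p ─ q)
p⊆p∩q∪p─q p q {x} x∈p with x ∈? q
... | yes x∈q = p⊆p∪q _ (x∈p∩q⁺ (x∈p , x∈q))
... | no x∉q = q⊆p∪q (p ∩ q) _ (x∈p∧x∉q⇒x∈p─q x∈p x∉q)

⊈-witness : ∀ {p q : Subset n} → ¬ p ⊆ q → ∃ λ x → x ∈ p × x ∉ q
⊈-witness {p = p} {q} p⊈q with any? (λ x → (x ∈? p) ×-dec ¬? (x ∈? q))
... | yes w = w
... | no none = contradiction (λ {x} x∈p → decidable-stable (x ∈? q) (λ x∉q → none (x , x∈p , x∉q))) p⊈q

other-or-⊆⁅x⁆ : ∀ (p : Subset n) x → (∃ λ y → y ∈ p × y ≢ x) ⊎ p ⊆ ⁅ x ⁆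
other-or-⊆⁅x⁆ p x with any? (λ y → (y ∈? p) ×-dec ¬? (y ≟ᶠ x))
... | yes w = inj₁ w
... | no none = inj₂ λ {y} y∈p →
  subst (_∈ ⁅ x ⁆) (sym (decidable-stable (y ≟ᶠ x) (λ y≢x → none (y , y∈p , y≢x)))) (x∈⁅x⁆ x)

x∉p⇒p⊆p-x : ∀ {x : Fin n} {p} → x ∉ p → p ⊆ p - x
x∉p⇒p⊆p-x x∉p y∈p = x∈p∧x≢y⇒x∈p-y y∈p (λ { refl → x∉p y∈p })

p∩q-x⊆p-x∩q : ∀ (p q : Subset n) x → (p ∩ q) - x ⊆ (p - x) ∩ q
p∩q-x⊆p-x∩q p q x y∈ =
  let (y∈p∩q , y≢x) = x∈p-y⁻ (p ∩ q) x y∈ ; (y∈p , y∈q) = x∈p∩q⁻ p q y∈p∩q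
  in x∈p∩q⁺ (x∈p∧x≢y⇒x∈p-y y∈p y≢x , y∈q)

p─q-x⊆p-x─q : ∀ (p q : Subset n) x → (p ─ q) - x ⊆ (p - x) ─ q
p─q-x⊆p-x─q p q x y∈ =
  let (y∈p─q , y≢x) = x∈p-y⁻ (p ─ q) x y∈ ; (y∈p , y∉q) = x∈p─q⁻ p q y∈p─q
  in x∈p∧x∉q⇒x∈p─q (x∈p∧x≢y⇒x∈p-y y∈p y≢x) y∉q

subsetOf : {P : Fin n → Set} → (∀ x → Dec (P x)) → Subset n
subsetOf {zero}  P? = []
subsetOf {suc n} P? = does (P? zero) ∷ subsetOf (P? ∘ suc)

∈subsetOf⁺ : ∀ {P : Fin n → Set} (P? : ∀ x → Dec (P x)) {x} → P x → x ∈ subsetOf P?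
∈subsetOf⁺ P? {zero} px with P? zero
... | yes _ = here
... | no ¬px = contradiction px ¬px
∈subsetOf⁺ P? {suc x} px = there (∈subsetOf⁺ (P? ∘ suc) px)

∈subsetOf⁻ : ∀ {P : Fin n → Set} (P? : ∀ x → Dec (P x)) {x} → x ∈ subsetOf P? → P x
∈subsetOf⁻ P? {zero} x∈ with P? zero | x∈
... | yes px | _ = px
... | no _   | ()
∈subsetOf⁻ P? {suc x} (there x∈) = ∈subsetOf⁻ (P? ∘ suc) x∈

∣p∣≡∣p∩q∣+∣p─q∣ : ∀ (p q : Subset n) → ∣ p ∣ ≡ ∣ p ∩ q ∣ + ∣ p ─ q ∣
∣p∣≡∣p∩q∣+∣p─q∣ []           []           = refl
∣p∣≡∣p∩q∣+∣p─q∣ (inside ∷ p)  (inside ∷ q)  = cong suc (∣p∣≡∣p∩q∣+∣p─q∣ p q)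
∣p∣≡∣p∩q∣+∣p─q∣ (inside ∷ p)  (outside ∷ q) = trans (cong suc (∣p∣≡∣p∩q∣+∣p─q∣ p q)) (sym (+-suc _ _))
∣p∣≡∣p∩q∣+∣p─q∣ (outside ∷ p) (inside ∷ q)  = ∣p∣≡∣p∩q∣+∣p─q∣ p q
∣p∣≡∣p∩q∣+∣p─q∣ (outside ∷ p) (outside ∷ q) = ∣p∣≡∣p∩q∣+∣p─q∣ p q

x∈p⇒∣p∣≡1+∣p-x∣ : ∀ {x : Fin n} p → x ∈ p → ∣ p ∣ ≡ suc ∣ p - x ∣
x∈p⇒∣p∣≡1+∣p-x∣ {x = zero}  (inside ∷ p)  here      = cong (suc ∘ ∣_∣) (sym (p─⊥≡p p))
x∈p⇒∣p∣≡1+∣p-x∣ {x = suc x} (inside ∷ p)  (there h) = cong suc (x∈p⇒∣p∣≡1+∣p-x∣ p h)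
x∈p⇒∣p∣≡1+∣p-x∣ {x = suc x} (outside ∷ p) (there h) = x∈p⇒∣p∣≡1+∣p-x∣ p h

x∉p⇒∣p∪⁅x⁆∣≡1+∣p∣ : ∀ {x : Fin n} p → x ∉ p → ∣ p ∪ ⁅ x ⁆ ∣ ≡ suc ∣ p ∣
x∉p⇒∣p∪⁅x⁆∣≡1+∣p∣ {x = zero}  (inside ∷ p)  x∉p = contradiction here x∉p
x∉p⇒∣p∪⁅x⁆∣≡1+∣p∣ {x = zero}  (outside ∷ p) x∉p = cong (suc ∘ ∣_∣) (∪-identityʳ p)
x∉p⇒∣p∪⁅x⁆∣≡1+∣p∣ {x = suc x} (inside ∷ p)  x∉p = cong suc (x∉p⇒∣p∪⁅x⁆∣≡1+∣p∣ p (x∉p ∘ there))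
x∉p⇒∣p∪⁅x⁆∣≡1+∣p∣ {x = suc x} (outside ∷ p) x∉p = x∉p⇒∣p∪⁅x⁆∣≡1+∣p∣ p (x∉p ∘ there)

-- Rank, independence and circuits

module RankProperties {n} (M : Matroid n) where

  mono : ∀ {X Y} → X ⊆ Y → rank M X ≤ rank M Y
  mono = rank-mono M _ _

  rank-Empty : ∀ {X} → Empty X → rank M X ≡ 0
  rank-Empty {X} X-empty = n≤0⇒n≡0 (begin
    rank M X  ≤⟨ rank-≤ M X ⟩
    ∣ X ∣     ≡⟨ cong ∣_∣ (Empty-unique X-empty) ⟩
    ∣ ⊥ {n} ∣ ≡⟨ ∣⊥∣≡0 n ⟩
    0         ∎)
    where open ≤-Reasoning

  subadditive : ∀ {X} Y Z → X ⊆ Y ∪ Z → rank M X ≤ rank M Y + rank M Z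
  subadditive Y Z X⊆ = ≤-trans (mono X⊆) (≤-trans (m≤m+n _ _) (rank-sub M Y Z))

  rank-⁅x⁆≤1 : ∀ x → rank M ⁅ x ⁆ ≤ 1
  rank-⁅x⁆≤1 x = ≤-trans (rank-≤ M ⁅ x ⁆) (≤-reflexive (∣⁅x⁆∣≡1 x))

  independent? : ∀ X → Dec (Independent M X)
  independent? X = rank M X ≟ ∣ X ∣

  nonLoop⇒independent : ∀ {x} → ¬ Loop M x → Independent M ⁅ x ⁆
  nonLoop⇒independent {x} nonLoop =
    trans (≤-antisym (rank-⁅x⁆≤1 x) (n≢0⇒n>0 nonLoop)) (sym (∣⁅x⁆∣≡1 x))

  independent-⊆ : ∀ {I Y} → Independent M I → Y ⊆ I → Independent M Y
  independent-⊆ {I} {Y} I-indep Y⊆I = ≤-antisym (rank-≤ M Y) (+-cancelʳ-≤ _ _ _ (begin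
    ∣ Y ∣ + ∣ I ─ Y ∣               ≡⟨ cong (λ Z → ∣ Z ∣ + ∣ I ─ Y ∣) (sym I∩Y≡Y) ⟩
    ∣ I ∩ Y ∣ + ∣ I ─ Y ∣           ≡⟨ sym (∣p∣≡∣p∩q∣+∣p─q∣ I Y) ⟩
    ∣ I ∣                           ≡⟨ sym I-indep ⟩
    rank M I                        ≤⟨ subadditive (I ∩ Y) (I ─ Y) (p⊆p∩q∪p─q I Y) ⟩
    rank M (I ∩ Y) + rank M (I ─ Y) ≤⟨ +-mono-≤ (mono (p∩q⊆q I Y)) (rank-≤ M (I ─ Y)) ⟩
    rank M Y + ∣ I ─ Y ∣            ∎))
    where
    open ≤-Reasoning
    I∩Y≡Y : I ∩ Y ≡ Y
    I∩Y≡Y = ⊆-antisym (p∩q⊆q I Y) (λ x∈Y → x∈p∩q⁺ (Y⊆I x∈Y , x∈Y))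

  rank-∪-absorb : ∀ Z C → rank M C ≤ rank M (Z ∩ C) → rank M (Z ∪ C) ≤ rank M Z
  rank-∪-absorb Z C C≤Z∩C = +-cancelʳ-≤ _ _ _ (begin
    rank M (Z ∪ C) + rank M (Z ∩ C) ≤⟨ rank-sub M Z C ⟩
    rank M Z + rank M C             ≤⟨ +-monoʳ-≤ (rank M Z) C≤Z∩C ⟩
    rank M Z + rank M (Z ∩ C)       ∎)
    where open ≤-Reasoning

module CircuitProperties {n} (M : Matroid n) where
  open RankProperties M

  circuit? : ∀ C → Dec (Circuit M C)
  circuit? C with independent? C | anySubset? (λ Y → (Y ⊂? C) ×-dec ¬? (independent? Y))
  ... | yes C-indep | _                 = no (λ C-circ → proj₁ C-circ C-indep)
  ... | no _        | yes (Y , Y⊂C , Y-dep) = no (λ C-circ → Y-dep (proj₂ C-circ Y Y⊂C))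
  ... | no C-dep    | no none           =
    yes (C-dep , λ Y Y⊂C → decidable-stable (independent? Y) (λ Y-dep → none (Y , Y⊂C , Y-dep)))

  circuit-nonempty : ∀ {C} → Circuit M C → Nonempty C
  circuit-nonempty {C} C-circ with nonempty? C
  ... | yes C≢∅ = C≢∅
  ... | no C-empty = contradiction
    (trans (rank-Empty C-empty) (sym (trans (cong ∣_∣ (Empty-unique C-empty)) (∣⊥∣≡0 n))))
    (proj₁ C-circ)

  circuit-rank-minus : ∀ {C c} → Circuit M C → c ∈ C → rank M C ≤ rank M (C - c)
  circuit-rank-minus {C} {c} (C-dep , minimal) c∈C = ≤-pred (begin-strict
    rank M C            <⟨ ≤∧≢⇒< (rank-≤ M C) C-dep ⟩
    ∣ C ∣               ≡⟨ x∈p⇒∣p∣≡1+∣p-x∣ C c∈C ⟩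
    suc ∣ C - c ∣       ≡⟨ cong suc (sym (minimal (C - c) (x∈p⇒p-x⊂p c∈C))) ⟩
    suc (rank M (C - c)) ∎)
    where open ≤-Reasoning

  circuit-closure : ∀ {C c X} Z → Circuit M C → c ∈ C → C - c ⊆ Z → X ⊆ Z ∪ C → rank M X ≤ rank M Z
  circuit-closure {C} {c} {X} Z C-circ c∈C C-c⊆Z X⊆ = ≤-trans (mono X⊆) (rank-∪-absorb Z C
    (≤-trans (circuit-rank-minus C-circ c∈C) (mono λ x∈ → x∈p∩q⁺ (C-c⊆Z x∈ , p-x⊆p C c x∈))))

  circuit-element-redundant : ∀ {C c X} → Circuit M C → c ∈ C → C ⊆ X → rank M X ≤ rank M (X - c)
  circuit-element-redundant {C} {c} {X} C-circ c∈C C⊆X =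
    circuit-closure (X - c) C-circ c∈C C-c⊆X-c (p⊆p-x∪q X c∈C)
    where
    C-c⊆X-c : C - c ⊆ X - c
    C-c⊆X-c x∈ = let (x∈C , x≢c) = x∈p-y⁻ C c x∈ in x∈p∧x≢y⇒x∈p-y (C⊆X x∈C) x≢c

  circuit-⊄ : ∀ {A B} → Circuit M A → Circuit M B → ¬ A ⊂ B
  circuit-⊄ {A} A-circ B-circ A⊂B = proj₁ A-circ (proj₂ B-circ A A⊂B)

  circuit-meets-outside : ∀ {C C₁ C₂ w} → Circuit M C → Circuit M C₁ → w ∈ C₁ → C ⊆ (C₁ ∪ C₂) - w →
                         ∃ λ u → u ∈ C × u ∉ C₁ × u ∈ C₂
  circuit-meets-outside {C} {C₁} {C₂} {w} C-circ C₁-circ w∈C₁ C⊆ with ⊈-witness C⊈C₁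
    where
    C⊈C₁ : ¬ C ⊆ C₁
    C⊈C₁ C⊆C₁ = circuit-⊄ C-circ C₁-circ (C⊆C₁ , w , w∈C₁ , x∉p-x _ w ∘ C⊆)
  ... | u , u∈C , u∉C₁ =
    u , u∈C , u∉C₁ , x∈p∪q∧x∉p⇒x∈q (p-x⊆p _ w (C⊆ u∈C)) u∉C₁

  dependent⇒∃circuit : ∀ D → ¬ Independent M D → ∃ λ C → Circuit M C × C ⊆ D
  dependent⇒∃circuit = ⊂-rec _ step
    where
    step : ∀ D → (∀ {Y} → Y ⊂ D → ¬ Independent M Y → ∃ λ C → Circuit M C × C ⊆ Y) →
           ¬ Independent M D → ∃ λ C → Circuit M C × C ⊆ D
    step D rec D-dep with anySubset? (λ Y → (Y ⊂? D) ×-dec ¬? (independent? Y))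
    ... | yes (Y , Y⊂D , Y-dep) =
      let (C , C-circ , C⊆Y) = rec Y⊂D Y-dep in C , C-circ , ⊆-trans C⊆Y (p⊂q⇒p⊆q Y⊂D)
    ... | no none =
      D , (D-dep , λ Y Y⊂D → decidable-stable (independent? Y) (λ Y-dep → none (Y , Y⊂D , Y-dep))) , ⊆-refl

  circuit-through : ∀ {c} Y → c ∉ Y → rank M (Y ∪ ⁅ c ⁆) ≤ rank M Y →
                    ∃ λ C → Circuit M C × c ∈ C × C ⊆ Y ∪ ⁅ c ⁆
  circuit-through {c} = ⊂-rec Goal step
    where
    Goal : Subset n → Set
    Goal Y = c ∉ Y → rank M (Y ∪ ⁅ c ⁆) ≤ rank M Y → ∃ λ C → Circuit M C × c ∈ C × C ⊆ Y ∪ ⁅ c ⁆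
    step : ∀ Y → (∀ {Y′} → Y′ ⊂ Y → Goal Y′) → Goal Y
    step Y rec c∉Y no-gain with independent? Y
    ... | yes Y-indep with dependent⇒∃circuit (Y ∪ ⁅ c ⁆) Y+c-dep
      where
      Y+c-dep : ¬ Independent M (Y ∪ ⁅ c ⁆)
      Y+c-dep Y+c-indep = 1+n≰n (begin
        suc (rank M Y)      ≡⟨ cong suc Y-indep ⟩
        suc ∣ Y ∣           ≡⟨ sym (x∉p⇒∣p∪⁅x⁆∣≡1+∣p∣ Y c∉Y) ⟩
        ∣ Y ∪ ⁅ c ⁆ ∣       ≡⟨ sym Y+c-indep ⟩
        rank M (Y ∪ ⁅ c ⁆)  ≤⟨ no-gain ⟩
        rank M Y            ∎)
        where open ≤-Reasoning
    ... | C , C-circ , C⊆ with c ∈? C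
    ...   | yes c∈C = C , C-circ , c∈C , C⊆
    ...   | no c∉C = contradiction (independent-⊆ Y-indep C⊆Y) (proj₁ C-circ)
      where
      C⊆Y : C ⊆ Y
      C⊆Y x∈C = [ (λ x∈Y → x∈Y) , (λ x∈⁅c⁆ → contradiction (subst (_∈ C) (x∈⁅y⁆⇒x≡y c x∈⁅c⁆) x∈C) c∉C) ]′
                  (x∈p∪q⁻ Y ⁅ c ⁆ (C⊆ x∈C))
    step Y rec c∉Y no-gain | no Y-dep with dependent⇒∃circuit Y Y-dep
    ... | C₀ , C₀-circ , C₀⊆Y with circuit-nonempty C₀-circ
    ...   | c₀ , c₀∈C₀ with rec (x∈p⇒p-x⊂p (C₀⊆Y c₀∈C₀)) (c∉Y ∘ p-x⊆p Y c₀) no-gain′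
      where
      no-gain′ : rank M ((Y - c₀) ∪ ⁅ c ⁆) ≤ rank M (Y - c₀)
      no-gain′ = begin
        rank M ((Y - c₀) ∪ ⁅ c ⁆) ≤⟨ mono (∪-least (p⊆p∪q _ ∘ p-x⊆p Y c₀) (q⊆p∪q Y _)) ⟩
        rank M (Y ∪ ⁅ c ⁆)        ≤⟨ no-gain ⟩
        rank M Y                  ≤⟨ circuit-element-redundant C₀-circ c₀∈C₀ C₀⊆Y ⟩
        rank M (Y - c₀)           ∎
        where open ≤-Reasoning
    ...     | C , C-circ , c∈C , C⊆ =
      C , C-circ , c∈C , ∪-least (p⊆p∪q _ ∘ p-x⊆p Y c₀) (q⊆p∪q Y _) ∘ C⊆

  strong-elimination : ∀ {C₁ C₂ e f} → Circuit M C₁ → Circuit M C₂ →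
                       e ∈ C₁ → e ∈ C₂ → f ∈ C₁ → f ∉ C₂ →
                       ∃ λ C → Circuit M C × f ∈ C × C ⊆ (C₁ ∪ C₂) - e
  strong-elimination {C₁} {C₂} {e} {f} C₁-circ C₂-circ e∈C₁ e∈C₂ f∈C₁ f∉C₂
    with circuit-through Y (x∉p-x _ f) no-gain
    where
    Y = ((C₁ ∪ C₂) - e) - f
    C₁-f⊆Y+e : C₁ - f ⊆ Y ∪ ⁅ e ⁆
    C₁-f⊆Y+e {x} x∈ with x ≟ᶠ e | x∈p-y⁻ C₁ f x∈
    ... | yes refl | _ = q⊆p∪q Y _ (x∈⁅x⁆ e)
    ... | no x≢e | x∈C₁ , x≢f = p⊆p∪q _ (x∈p∧x≢y⇒x∈p-y (x∈p∧x≢y⇒x∈p-y (p⊆p∪q C₂ x∈C₁) x≢e) x≢f)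
    C₂-e⊆Y : C₂ - e ⊆ Y
    C₂-e⊆Y x∈ = let (x∈C₂ , x≢e) = x∈p-y⁻ C₂ e x∈ in
      x∈p∧x≢y⇒x∈p-y (x∈p∧x≢y⇒x∈p-y (q⊆p∪q C₁ C₂ x∈C₂) x≢e) (λ { refl → f∉C₂ x∈C₂ })
    no-gain : rank M (Y ∪ ⁅ f ⁆) ≤ rank M Y
    no-gain = begin
      rank M (Y ∪ ⁅ f ⁆) ≤⟨ circuit-closure (Y ∪ ⁅ e ⁆) C₁-circ f∈C₁ C₁-f⊆Y+e
                              (∪-least (p⊆p∪q C₁ ∘ p⊆p∪q _) (q⊆p∪q _ C₁ ∘ ⁅x⁆⊆p f∈C₁)) ⟩
      rank M (Y ∪ ⁅ e ⁆) ≤⟨ circuit-closure Y C₂-circ e∈C₂ C₂-e⊆Y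
                              (∪-least (p⊆p∪q C₂) (q⊆p∪q Y C₂ ∘ ⁅x⁆⊆p e∈C₂)) ⟩
      rank M Y           ∎
      where open ≤-Reasoning
  ... | C , C-circ , f∈C , C⊆ =
    C , C-circ , f∈C , ∪-least (p-x⊆p _ f) (⁅x⁆⊆p (x∈p∧x≢y⇒x∈p-y (p⊆p∪q C₂ f∈C₁) λ { refl → f∉C₂ e∈C₂ })) ∘ C⊆

-- Restriction to a subset S, re-indexed by Fin ∣ S ∣

embed : (S : Subset n) → Fin ∣ S ∣ → Fin n
embed (inside ∷ S)  zero    = zero
embed (inside ∷ S)  (suc i) = suc (embed S i)
embed (outside ∷ S) i       = suc (embed S i)

image : (S : Subset n) → Subset ∣ S ∣ → Subset n
image []            X       = []
image (inside ∷ S)  (b ∷ X) = b ∷ image S X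
image (outside ∷ S) X       = outside ∷ image S X

preimage : (S : Subset n) → Subset n → Subset ∣ S ∣
preimage []            Y       = []
preimage (inside ∷ S)  (b ∷ Y) = b ∷ preimage S Y
preimage (outside ∷ S) (b ∷ Y) = preimage S Y

extendAlong : {V : Set} (S : Subset n) → V → (Fin ∣ S ∣ → V) → Fin n → V
extendAlong (inside ∷ S)  d f zero    = f zero
extendAlong (inside ∷ S)  d f (suc y) = extendAlong S d (f ∘ suc) y
extendAlong (outside ∷ S) d f zero    = d
extendAlong (outside ∷ S) d f (suc y) = extendAlong S d f y

embed∈ : ∀ (S : Subset n) i → embed S i ∈ S
embed∈ (inside ∷ S)  zero    = here
embed∈ (inside ∷ S)  (suc i) = there (embed∈ S i)
embed∈ (outside ∷ S) i       = there (embed∈ S i)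

embed-injective : ∀ (S : Subset n) {i j} → embed S i ≡ embed S j → i ≡ j
embed-injective (inside ∷ S)  {zero}  {zero}  _ = refl
embed-injective (inside ∷ S)  {suc i} {suc j} e = cong suc (embed-injective S (Finₚ.suc-injective e))
embed-injective (outside ∷ S) e = embed-injective S (Finₚ.suc-injective e)

embed-surjective : ∀ (S : Subset n) {y} → y ∈ S → ∃ λ i → embed S i ≡ y
embed-surjective (inside ∷ S)  {zero}  here = zero , refl
embed-surjective (inside ∷ S)  {suc y} (there y∈) = let (i , e) = embed-surjective S y∈ in suc i , cong suc e
embed-surjective (outside ∷ S) {suc y} (there y∈) = let (i , e) = embed-surjective S y∈ in i , cong suc e

∈image⁺ : ∀ (S : Subset n) X {i} → i ∈ X → embed S i ∈ image S X
∈image⁺ (inside ∷ S)  (b ∷ X) {zero}  here       = here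
∈image⁺ (inside ∷ S)  (b ∷ X) {suc i} (there i∈) = there (∈image⁺ S X i∈)
∈image⁺ (outside ∷ S) X i∈ = there (∈image⁺ S X i∈)

∈image⁻ : ∀ (S : Subset n) X {y} → y ∈ image S X → ∃ λ i → i ∈ X × embed S i ≡ y
∈image⁻ (inside ∷ S)  (b ∷ X) {zero}  here = zero , here , refl
∈image⁻ (inside ∷ S)  (b ∷ X) {suc y} (there y∈) =
  let (i , i∈ , e) = ∈image⁻ S X y∈ in suc i , there i∈ , cong suc e
∈image⁻ (outside ∷ S) X {suc y} (there y∈) =
  let (i , i∈ , e) = ∈image⁻ S X y∈ in i , i∈ , cong suc e

image-mono : ∀ (S : Subset n) {X Y} → X ⊆ Y → image S X ⊆ image S Y
image-mono S {X} {Y} X⊆Y y∈ with ∈image⁻ S X y∈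
... | i , i∈X , refl = ∈image⁺ S Y (X⊆Y i∈X)

image-∪ : ∀ (S : Subset n) X Y → image S (X ∪ Y) ≡ image S X ∪ image S Y
image-∪ []            []      []      = refl
image-∪ (inside ∷ S)  (a ∷ X) (b ∷ Y) = cong (_ ∷_) (image-∪ S X Y)
image-∪ (outside ∷ S) X       Y       = cong (_ ∷_) (image-∪ S X Y)

image-∩ : ∀ (S : Subset n) X Y → image S (X ∩ Y) ≡ image S X ∩ image S Y
image-∩ []            []      []      = refl
image-∩ (inside ∷ S)  (a ∷ X) (b ∷ Y) = cong (_ ∷_) (image-∩ S X Y)
image-∩ (outside ∷ S) X       Y       = cong (_ ∷_) (image-∩ S X Y)

∣image∣ : ∀ (S : Subset n) X → ∣ image S X ∣ ≡ ∣ X ∣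
∣image∣ []            []            = refl
∣image∣ (inside ∷ S)  (inside ∷ X)  = cong suc (∣image∣ S X)
∣image∣ (inside ∷ S)  (outside ∷ X) = ∣image∣ S X
∣image∣ (outside ∷ S) X             = ∣image∣ S X

image-⊤ : ∀ (S : Subset n) → image S ⊤ ≡ S
image-⊤ S = ⊆-antisym image⊆S S⊆image
  where
  image⊆S : image S ⊤ ⊆ S
  image⊆S y∈ with ∈image⁻ S ⊤ y∈
  ... | i , _ , refl = embed∈ S i
  S⊆image : S ⊆ image S ⊤
  S⊆image y∈S with embed-surjective S y∈S
  ... | i , refl = ∈image⁺ S ⊤ ∈⊤

∈preimage⁺ : ∀ (S : Subset n) Y {i} → embed S i ∈ Y → i ∈ preimage S Y
∈preimage⁺ (inside ∷ S)  (b ∷ Y) {zero}  here       = here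
∈preimage⁺ (inside ∷ S)  (b ∷ Y) {suc i} (there i∈) = there (∈preimage⁺ S Y i∈)
∈preimage⁺ (outside ∷ S) (b ∷ Y) (there i∈) = ∈preimage⁺ S Y i∈

∈preimage⁻ : ∀ (S : Subset n) Y {i} → i ∈ preimage S Y → embed S i ∈ Y
∈preimage⁻ (inside ∷ S)  (b ∷ Y) {zero}  here       = here
∈preimage⁻ (inside ∷ S)  (b ∷ Y) {suc i} (there i∈) = there (∈preimage⁻ S Y i∈)
∈preimage⁻ (outside ∷ S) (b ∷ Y) i∈ = there (∈preimage⁻ S Y i∈)

image-preimage : ∀ (S : Subset n) {Y} → Y ⊆ S → image S (preimage S Y) ≡ Y
image-preimage S {Y} Y⊆S = ⊆-antisym image⊆Y Y⊆image
  where
  image⊆Y : image S (preimage S Y) ⊆ Y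
  image⊆Y y∈ with ∈image⁻ S (preimage S Y) y∈
  ... | i , i∈ , refl = ∈preimage⁻ S Y i∈
  Y⊆image : Y ⊆ image S (preimage S Y)
  Y⊆image y∈Y with embed-surjective S (Y⊆S y∈Y)
  ... | i , refl = ∈image⁺ S (preimage S Y) (∈preimage⁺ S Y y∈Y)

extendAlong-embed : ∀ {V : Set} (S : Subset n) (d : V) f i → extendAlong S d f (embed S i) ≡ f i
extendAlong-embed (inside ∷ S)  d f zero    = refl
extendAlong-embed (inside ∷ S)  d f (suc i) = extendAlong-embed S d (f ∘ suc) i
extendAlong-embed (outside ∷ S) d f i       = extendAlong-embed S d f i

restriction : Matroid n → (S : Subset n) → Matroid ∣ S ∣
restriction M S = record
  { rank      = λ X → rank M (image S X)
  ; rank-≤    = λ X → ≤-trans (rank-≤ M (image S X)) (≤-reflexive (∣image∣ S X))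
  ; rank-mono = λ X Y X⊆Y → rank-mono M _ _ (image-mono S X⊆Y)
  ; rank-sub  = λ X Y → subst₂ (λ A B → rank M A + rank M B ≤ rank M (image S X) + rank M (image S Y))
                               (sym (image-∪ S X Y)) (sym (image-∩ S X Y)) (rank-sub M (image S X) (image S Y))
  }

restriction-isRestriction : ∀ (M : Matroid n) S → IsRestrictionVia M S (restriction M S) (embed S)
restriction-isRestriction M S =
  (λ i j → embed-injective S) , (λ y → embed-surjective S) , embed∈ S ,
  λ X Y Y⊆ image⊆ → cong (rank M) (⊆-antisym (image⊆Y X Y image⊆) (Y⊆image X Y Y⊆))
  where
  image⊆Y : ∀ X Y → (∀ i → i ∈ X → embed S i ∈ Y) → image S X ⊆ Y
  image⊆Y X Y image⊆ y∈ with ∈image⁻ S X y∈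
  ... | i , i∈X , refl = image⊆ i i∈X
  Y⊆image : ∀ X Y → (∀ y → y ∈ Y → ∃ λ i → i ∈ X × embed S i ≡ y) → Y ⊆ image S X
  Y⊆image X Y Y⊆ {y} y∈Y with Y⊆ y y∈Y
  ... | i , i∈X , refl = ∈image⁺ S X i∈X

circuit-restriction : ∀ (M : Matroid n) {S C} → Circuit M C → C ⊆ S → Circuit (restriction M S) (preimage S C)
circuit-restriction M {S} {C} (C-dep , minimal) C⊆S = dependent , λ Y → proper-independent Y
  where
  C-image = image-preimage S C⊆S
  dependent : ¬ Independent (restriction M S) (preimage S C)
  dependent indep = C-dep (begin
    rank M C                          ≡⟨ cong (rank M) (sym C-image) ⟩
    rank M (image S (preimage S C))   ≡⟨ indep ⟩
    ∣ preimage S C ∣                  ≡⟨ sym (∣image∣ S (preimage S C)) ⟩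
    ∣ image S (preimage S C) ∣        ≡⟨ cong ∣_∣ C-image ⟩
    ∣ C ∣                             ∎)
    where open ≡-Reasoning
  proper-independent : ∀ Y → Y ⊂ preimage S C → Independent (restriction M S) Y
  proper-independent Y (Y⊆ , i , i∈ , i∉Y) =
    trans (minimal (image S Y) (image⊆C , embed S i , ∈preimage⁻ S C i∈ , embed-i∉)) (∣image∣ S Y)
    where
    image⊆C : image S Y ⊆ C
    image⊆C = subst (image S Y ⊆_) C-image (image-mono S Y⊆)
    embed-i∉ : embed S i ∉ image S Y
    embed-i∉ i∈ with ∈image⁻ S Y i∈
    ... | j , j∈Y , e = i∉Y (subst (_∈ Y) (embed-injective S e) j∈Y)

-- Components

SharedCircuit : Matroid n → Fin n → Fin n → Set
SharedCircuit M x y = ∃ λ C → Circuit M C × x ∈ C × y ∈ C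

module ComponentProperties {n} (M : Matroid n) where
  open RankProperties M
  open CircuitProperties M

  sharedCircuit? : ∀ x y → Dec (SharedCircuit M x y)
  sharedCircuit? x y = anySubset? (λ C → circuit? C ×-dec (x ∈? C) ×-dec (y ∈? C))

  SharedCircuit-sym : ∀ {x y} → SharedCircuit M x y → SharedCircuit M y x
  SharedCircuit-sym (C , C-circ , x∈C , y∈C) = C , C-circ , y∈C , x∈C

  -- Induction on C₁ ∪ C₂.  Strong elimination gives circuits C₃ ∋ x and C₄ ∋ z
  -- avoiding w; if they meet, C₃ ∪ C₄ is smaller, otherwise C₃ meets C₂ and
  -- C₃ ∪ C₂ misses an element of C₄ ∖ C₂.
  meeting-circuits⇒SharedCircuit : ∀ {C₁ C₂ w x z} → Circuit M C₁ → Circuit M C₂ → w ∈ C₁ → w ∈ C₂ →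
                                   x ∈ C₁ → z ∈ C₂ → x ≢ z → SharedCircuit M x z
  meeting-circuits⇒SharedCircuit {C₁} {C₂} = ⊂-rec Goal step (C₁ ∪ C₂) refl
    where
    Goal : Subset n → Set
    Goal U = ∀ {C₁ C₂ w x z} → C₁ ∪ C₂ ≡ U → Circuit M C₁ → Circuit M C₂ → w ∈ C₁ → w ∈ C₂ →
             x ∈ C₁ → z ∈ C₂ → x ≢ z → SharedCircuit M x z
    step : ∀ U → (∀ {U′} → U′ ⊂ U → Goal U′) → Goal U
    step _ rec {C₁} {C₂} {w} {x} {z} refl C₁-circ C₂-circ w∈C₁ w∈C₂ x∈C₁ z∈C₂ x≢z with z ∈? C₁ | x ∈? C₂
    ... | yes z∈C₁ | _        = C₁ , C₁-circ , x∈C₁ , z∈C₁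
    ... | no _     | yes x∈C₂ = C₂ , C₂-circ , x∈C₂ , z∈C₂
    ... | no z∉C₁  | no x∉C₂
      with strong-elimination C₁-circ C₂-circ w∈C₁ w∈C₂ x∈C₁ x∉C₂
         | strong-elimination C₂-circ C₁-circ w∈C₂ w∈C₁ z∈C₂ z∉C₁
    ... | C₃ , C₃-circ , x∈C₃ , C₃⊆ | C₄ , C₄-circ , z∈C₄ , C₄⊆
      with any? (λ u → (u ∈? C₃) ×-dec (u ∈? C₄))
    ... | yes (u , u∈C₃ , u∈C₄) = rec C₃∪C₄⊂ refl C₃-circ C₄-circ u∈C₃ u∈C₄ x∈C₃ z∈C₄ x≢z
      where
      C₃∪C₄⊂ : C₃ ∪ C₄ ⊂ C₁ ∪ C₂
      C₃∪C₄⊂ = ⊆-⊂-trans (∪-least C₃⊆ (subst (λ V → C₄ ⊆ V - w) (∪-comm C₂ C₁) C₄⊆))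
                         (x∈p⇒p-x⊂p (p⊆p∪q C₂ w∈C₁))
    ... | no disjoint with circuit-meets-outside C₃-circ C₁-circ w∈C₁ C₃⊆
                         | circuit-meets-outside C₄-circ C₂-circ w∈C₂ C₄⊆
    ...   | u , u∈C₃ , _ , u∈C₂ | v , v∈C₄ , v∉C₂ , v∈C₁ =
      rec C₃∪C₂⊂ refl C₃-circ C₂-circ u∈C₃ u∈C₂ x∈C₃ z∈C₂ x≢z
      where
      C₃∪C₂⊂ : C₃ ∪ C₂ ⊂ C₁ ∪ C₂
      C₃∪C₂⊂ = ∪-least (p-x⊆p _ w ∘ C₃⊆) (q⊆p∪q C₁ C₂) , v , p⊆p∪q C₂ v∈C₁ ,
               λ v∈ → [ (λ v∈C₃ → disjoint (v , v∈C₃ , v∈C₄)) , v∉C₂ ]′ (x∈p∪q⁻ C₃ C₂ v∈)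

  SharedCircuit-trans : ∀ {x y z} → SharedCircuit M x y → SharedCircuit M y z → x ≢ z → SharedCircuit M x z
  SharedCircuit-trans (_ , C₁-circ , x∈C₁ , y∈C₁) (_ , C₂-circ , y∈C₂ , z∈C₂) =
    meeting-circuits⇒SharedCircuit C₁-circ C₂-circ y∈C₁ y∈C₂ x∈C₁ z∈C₂

  infix 4 _∼_ _∼?_

  _∼_ : Fin n → Fin n → Set
  x ∼ y = x ≡ y ⊎ SharedCircuit M x y

  _∼?_ : ∀ x y → Dec (x ∼ y)
  x ∼? y = (x ≟ᶠ y) ⊎-dec sharedCircuit? x y

  ∼-sym : ∀ {x y} → x ∼ y → y ∼ x
  ∼-sym (inj₁ refl) = inj₁ refl
  ∼-sym (inj₂ xy)   = inj₂ (SharedCircuit-sym xy)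

  ∼-trans : ∀ {x y z} → x ∼ y → y ∼ z → x ∼ z
  ∼-trans (inj₁ refl) y∼z = y∼z
  ∼-trans x∼y (inj₁ refl) = x∼y
  ∼-trans {x} {_} {z} (inj₂ xy) (inj₂ yz) with x ≟ᶠ z
  ... | yes x≡z = inj₁ x≡z
  ... | no x≢z  = inj₂ (SharedCircuit-trans xy yz x≢z)

  ∼⇒SharedCircuit : ∀ {x y} → x ∼ y → x ≢ y → SharedCircuit M x y
  ∼⇒SharedCircuit (inj₁ x≡y) x≢y = contradiction x≡y x≢y
  ∼⇒SharedCircuit (inj₂ xy)  _   = xy

  component : Fin n → Subset n
  component x = subsetOf (x ∼?_)

  ∈component⁺ : ∀ {x y} → x ∼ y → y ∈ component x
  ∈component⁺ {x} = ∈subsetOf⁺ (x ∼?_)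

  ∈component⁻ : ∀ {x y} → y ∈ component x → x ∼ y
  ∈component⁻ {x} = ∈subsetOf⁻ (x ∼?_)

  x∈component : ∀ x → x ∈ component x
  x∈component x = ∈component⁺ (inj₁ refl)

  component-⊆ : ∀ {x y} → y ∈ component x → component y ⊆ component x
  component-⊆ y∈ z∈ = ∈component⁺ (∼-trans (∈component⁻ y∈) (∈component⁻ z∈))

  component-isComponent : ∀ x → IsComponent M (component x)
  component-isComponent x = linked , maximal
    where
    linked : Linked M (component x)
    linked y z y∈ z∈ = ∼⇒SharedCircuit (∼-trans (∼-sym (∈component⁻ y∈)) (∈component⁻ z∈))
    maximal : ∀ T → component x ⊆ T → Linked M T → T ⊆ component x
    maximal T ⊆T T-linked {t} t∈T with x ≟ᶠ t
    ... | yes x≡t = ∈component⁺ (inj₁ x≡t)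
    ... | no x≢t  = ∈component⁺ (inj₂ (T-linked x t (⊆T (x∈component x)) t∈T x≢t))

  connected⇒in-circuit : 2 ≤ n → Connected M → ∀ x → ∃ λ C → Circuit M C × x ∈ C
  connected⇒in-circuit 2≤n (S , _ , unique) x with another-element 2≤n x
  ... | y , y≢x with ∼⇒SharedCircuit (∈component⁻ x∈component-y) y≢x
    where
    x∈component-y : x ∈ component y
    x∈component-y = subst (x ∈_) (trans (unique _ (component-isComponent x)) (sym (unique _ (component-isComponent y))))
                          (x∈component x)
  ... | C , C-circ , _ , x∈C = C , C-circ , x∈C

  Separator : Subset n → Set
  Separator S = ∀ {C a b} → Circuit M C → a ∈ C → b ∈ C → a ∈ S → b ∈ S

  component-separator : ∀ x → Separator (component x)
  component-separator x {a = a} {b} C-circ a∈C b∈C a∈ with a ≟ᶠ b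
  ... | yes refl = a∈
  ... | no a≢b  = ∈component⁺ (∼-trans (∈component⁻ a∈) (inj₂ (_ , C-circ , a∈C , b∈C)))

  separator-additive : ∀ {S} → Separator S → ∀ X → rank M X ≡ rank M (X ∩ S) + rank M (X ─ S)
  separator-additive {S} sep X = ≤-antisym (subadditive _ _ (p⊆p∩q∪p─q X S)) (⊂-rec Goal step X)
    where
    open ≤-Reasoning
    Goal : Subset n → Set
    Goal X = rank M (X ∩ S) + rank M (X ─ S) ≤ rank M X
    step : ∀ X → (∀ {Y} → Y ⊂ X → Goal Y) → Goal X
    step X rec with independent? X
    ... | yes X-indep = begin
      rank M (X ∩ S) + rank M (X ─ S) ≡⟨ cong₂ _+_ (independent-⊆ X-indep (p∩q⊆p X S))
                                                   (independent-⊆ X-indep (p─q⊆p X S)) ⟩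
      ∣ X ∩ S ∣ + ∣ X ─ S ∣           ≡⟨ sym (∣p∣≡∣p∩q∣+∣p─q∣ X S) ⟩
      ∣ X ∣                           ≡⟨ sym X-indep ⟩
      rank M X                        ∎
    ... | no X-dep with dependent⇒∃circuit X X-dep
    ... | C , C-circ , C⊆X with circuit-nonempty C-circ
    ... | c , c∈C = begin
      rank M (X ∩ S) + rank M (X ─ S)             ≤⟨ +-mono-≤ (proj₁ parts) (proj₂ parts) ⟩
      rank M ((X ∩ S) - c) + rank M ((X ─ S) - c) ≤⟨ +-mono-≤ (mono (p∩q-x⊆p-x∩q X S c)) (mono (p─q-x⊆p-x─q X S c)) ⟩
      rank M ((X - c) ∩ S) + rank M ((X - c) ─ S) ≤⟨ rec (x∈p⇒p-x⊂p (C⊆X c∈C)) ⟩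
      rank M (X - c)                              ≤⟨ mono (p-x⊆p X c) ⟩
      rank M X                                    ∎
      where
      parts : rank M (X ∩ S) ≤ rank M ((X ∩ S) - c) × rank M (X ─ S) ≤ rank M ((X ─ S) - c)
      parts with c ∈? S
      ... | yes c∈S = circuit-element-redundant C-circ c∈C C⊆X∩S , mono (x∉p⇒p⊆p-x c∉X─S)
        where
        C⊆X∩S : C ⊆ X ∩ S
        C⊆X∩S x∈C = x∈p∩q⁺ (C⊆X x∈C , sep C-circ c∈C x∈C c∈S)
        c∉X─S : c ∉ X ─ S
        c∉X─S c∈ = proj₂ (x∈p─q⁻ X S c∈) c∈S
      ... | no c∉S = mono (x∉p⇒p⊆p-x (c∉S ∘ proj₂ ∘ x∈p∩q⁻ X S)) , circuit-element-redundant C-circ c∈C C⊆X─S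
        where
        C⊆X─S : C ⊆ X ─ S
        C⊆X─S x∈C = x∈p∧x∉q⇒x∈p─q (C⊆X x∈C) (λ x∈S → c∉S (sep C-circ x∈C c∈C x∈S))

  circuit⊆component : ∀ {C x} → Circuit M C → x ∈ C → C ⊆ component x
  circuit⊆component {x = x} C-circ x∈C z∈C = component-separator x C-circ x∈C z∈C (x∈component x)

  SharedCircuit-component : ∀ {x y} → SharedCircuit M x y → x ≢ y →
    ∃ λ i → ∃ λ j → i ≢ j × SharedCircuit (restriction M (component x)) i j
  SharedCircuit-component {x} {y} (C , C-circ , x∈C , y∈C) x≢y
    with embed-surjective (component x) (x∈component x) | embed-surjective (component x) (circuit⊆component C-circ x∈C y∈C)
  ... | i , embed-i≡x | j , embed-j≡y =
    i , j , (λ i≡j → x≢y (trans (sym embed-i≡x) (trans (cong (embed (component x)) i≡j) embed-j≡y))) ,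
    preimage (component x) C , circuit-restriction M C-circ (circuit⊆component C-circ x∈C) ,
    ∈preimage⁺ (component x) C (subst (_∈ C) (sym embed-i≡x) x∈C) ,
    ∈preimage⁺ (component x) C (subst (_∈ C) (sym embed-j≡y) y∈C)

  SharedCircuit⇒nonLoop-nonColoop : ∀ {x y} → SharedCircuit M x y → x ≢ y → ¬ Loop M x × ¬ Coloop M x
  SharedCircuit⇒nonLoop-nonColoop {x} {y} (C , C-circ , x∈C , y∈C) x≢y = nonLoop , nonColoop
    where
    ⁅x⁆-indep : Independent M ⁅ x ⁆
    ⁅x⁆-indep = proj₂ C-circ ⁅ x ⁆ (⁅x⁆⊆p x∈C , y , y∈C , x≢y ∘ sym ∘ x∈⁅y⁆⇒x≡y x)
    nonLoop : ¬ Loop M x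
    nonLoop x-loop = contradiction (trans (sym (∣⁅x⁆∣≡1 x)) (trans (sym ⁅x⁆-indep) x-loop)) λ ()
    nonColoop : ¬ Coloop M x
    nonColoop x-coloop = <⇒≱ x-coloop (circuit-element-redundant C-circ x∈C ⊆⊤)

  nonLoop-nonColoop⇒SharedCircuit : ∀ {x} → ¬ Loop M x → ¬ Coloop M x → ∃ λ y → y ≢ x × SharedCircuit M x y
  nonLoop-nonColoop⇒SharedCircuit {x} nonLoop nonColoop
    with circuit-through (⊤ - x) (x∉p-x ⊤ x) (≤-trans (mono ⊆⊤) (≮⇒≥ nonColoop))
  ... | C , C-circ , x∈C , _ with other-or-⊆⁅x⁆ C x
  ...   | inj₁ (y , y∈C , y≢x) = y , y≢x , C , C-circ , x∈C , y∈C
  ...   | inj₂ C⊆⁅x⁆ = contradiction (independent-⊆ (nonLoop⇒independent nonLoop) C⊆⁅x⁆) (proj₁ C-circ)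

-- Rooted trees

module TreeProperties (T : RootedTree) where

  root∈ancestorsUpTo : ∀ k v → toℕ v ≤ k → zero ∈ ancestorsUpTo T k v
  root∈ancestorsUpTo zero    zero    _         = here
  root∈ancestorsUpTo (suc k) zero    _         = here
  root∈ancestorsUpTo (suc k) (suc i) (s≤s i≤k) =
    q⊆p∪q ⁅ suc i ⁆ _ (root∈ancestorsUpTo k (parent T i) (≤-trans (parent-< T i) i≤k))

  root∈rootPath : ∀ v → zero ∈ rootPath T v
  root∈rootPath v = root∈ancestorsUpTo (edges T) v (≤-pred (Finₚ.toℕ<n v))

  -- Parents have smaller indices, so toℕ v steps already reach the root.
  ancestorsUpTo-stable : ∀ k k′ v → toℕ v ≤ k → toℕ v ≤ k′ → ancestorsUpTo T k v ≡ ancestorsUpTo T k′ v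
  ancestorsUpTo-stable zero    zero     v       _         _          = refl
  ancestorsUpTo-stable zero    (suc k′) zero    _         _          = refl
  ancestorsUpTo-stable (suc k) zero     zero    _         _          = refl
  ancestorsUpTo-stable (suc k) (suc k′) zero    _         _          = refl
  ancestorsUpTo-stable (suc k) (suc k′) (suc i) (s≤s i≤k) (s≤s i≤k′) =
    cong (⁅ suc i ⁆ ∪_) (ancestorsUpTo-stable k k′ (parent T i)
                           (≤-trans (parent-< T i) i≤k) (≤-trans (parent-< T i) i≤k′))

  rootPath-ancestorsUpTo : ∀ k v → toℕ v ≤ k → rootPath T v ≡ ancestorsUpTo T k v
  rootPath-ancestorsUpTo k v v≤k = ancestorsUpTo-stable (edges T) k v (≤-pred (Finₚ.toℕ<n v)) v≤k

  lastVertex : Fin (suc (edges T))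
  lastVertex = fromℕ (edges T)

  lastVertex-leaf : IsLeaf T lastVertex
  lastVertex-leaf i parent≡last = <⇒≱ (Finₚ.toℕ<n i) (begin
    edges T               ≡⟨ sym (Finₚ.toℕ-fromℕ (edges T)) ⟩
    toℕ lastVertex        ≡⟨ cong toℕ (sym parent≡last) ⟩
    toℕ (parent T i)      ≤⟨ parent-< T i ⟩
    toℕ i                 ∎)
    where open ≤-Reasoning

  root-not-leaf : Fin (edges T) → ¬ IsLeaf T zero
  root-not-leaf i root-leaf = root-leaf first-edge (Finₚ.toℕ-injective (n≤0⇒n≡0 (begin
    toℕ (parent T first-edge) ≤⟨ parent-< T first-edge ⟩
    toℕ first-edge            ≡⟨ Finₚ.toℕ-fromℕ< _ ⟩
    0                         ∎)))
    where
    open ≤-Reasoning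
    first-edge : Fin (edges T)
    first-edge = fromℕ< (≤-trans (s≤s z≤n) (Finₚ.toℕ<n i))

  leaf⇒suc : ∀ {v} → Fin (edges T) → IsLeaf T v → ∃ λ w → v ≡ suc w
  leaf⇒suc {zero}  i v-leaf = contradiction v-leaf (root-not-leaf i)
  leaf⇒suc {suc w} _ _      = w , refl

∈unionOver⁺ : ∀ {k} (X : Subset n) (g : Fin n → Subset k) {v x} → x ∈ X → v ∈ g x → v ∈ unionOver X g
∈unionOver⁺ (inside ∷ X) g {x = zero}  here       v∈ = p⊆p∪q _ v∈
∈unionOver⁺ (b ∷ X)      g {x = suc x} (there x∈) v∈ = q⊆p∪q _ _ (∈unionOver⁺ X (g ∘ suc) x∈ v∈)

∈unionOver⁻ : ∀ {k} (X : Subset n) (g : Fin n → Subset k) {v} → v ∈ unionOver X g → ∃ λ x → x ∈ X × v ∈ g x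
∈unionOver⁻ []      g v∈ = contradiction v∈ ∉⊥
∈unionOver⁻ (b ∷ X) g v∈ with b | x∈p∪q⁻ (if b then g zero else ⊥) (unionOver X (g ∘ suc)) v∈
... | inside  | inj₁ v∈g₀ = zero , here , v∈g₀
... | outside | inj₁ v∈⊥  = contradiction v∈⊥ ∉⊥
... | _       | inj₂ v∈′  = let (x , x∈ , v∈gx) = ∈unionOver⁻ X (g ∘ suc) v∈′ in suc x , there x∈ , v∈gx

∈tail⁺ : ∀ {m} (A : Subset (suc m)) {i} → suc i ∈ A → i ∈ tail A
∈tail⁺ (a ∷ A) (there i∈) = i∈

∈tail⁻ : ∀ {m} (A : Subset (suc m)) {i} → i ∈ tail A → suc i ∈ A
∈tail⁻ (a ∷ A) i∈ = there i∈

∣tail∣-mono : ∀ {m} {A B : Subset (suc m)} → (∀ {i} → suc i ∈ A → suc i ∈ B) → ∣ tail A ∣ ≤ ∣ tail B ∣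
∣tail∣-mono {A = a ∷ A} {B} sA⊆sB = p⊆q⇒∣p∣≤∣q∣ (∈tail⁺ B ∘ sA⊆sB ∘ there)

edgesOfUnionOfPaths-mono : ∀ {n m} T {f : Fin n → Fin (suc (edges T))} {g : Fin m → Fin (suc (edges T))} {X Y} →
  (∀ {x} → x ∈ X → ∃ λ y → y ∈ Y × f x ≡ g y) → edgesOfUnionOfPaths T f X ≤ edgesOfUnionOfPaths T g Y
edgesOfUnionOfPaths-mono T {f} {g} {X} {Y} X↝Y = ∣tail∣-mono λ v∈ →
  let (x , x∈X , v∈path) = ∈unionOver⁻ X (rootPath T ∘ f) v∈
      (y , y∈Y , fx≡gy)  = X↝Y x∈X
  in ∈unionOver⁺ Y (rootPath T ∘ g) y∈Y (subst (λ w → _ ∈ rootPath T w) fx≡gy v∈path)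

trivialTree : RootedTree
trivialTree = record { edges = 0 ; parent = λ () ; parent-< = λ () }

singleEdgeTree : RootedTree
singleEdgeTree = record { edges = 1 ; parent = λ _ → zero ; parent-< = λ _ → z≤n }

rootExtension : RootedTree → RootedTree
rootExtension T = record { edges = suc (edges T) ; parent = parent′ ; parent-< = parent′-< }
  where
  parent′ : Fin (suc (edges T)) → Fin (suc (suc (edges T)))
  parent′ zero    = zero
  parent′ (suc i) = suc (parent T i)
  parent′-< : ∀ i → toℕ (parent′ i) ≤ toℕ i
  parent′-< zero    = z≤n
  parent′-< (suc i) = s≤s (parent-< T i)

module _ (T : RootedTree) where

  ancestorsUpTo-rootExtension : ∀ k v → toℕ v ≤ k →
    ancestorsUpTo (rootExtension T) (suc k) (suc v) ≡ inside ∷ ancestorsUpTo T k v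
  ancestorsUpTo-rootExtension zero    zero    _         = cong (λ A → inside ∷ inside ∷ A) (∪-identityʳ ⊥)
  ancestorsUpTo-rootExtension (suc k) zero    _         = cong (λ A → inside ∷ inside ∷ A) (∪-identityʳ ⊥)
  ancestorsUpTo-rootExtension (suc k) (suc i) (s≤s i≤k) =
    cong (⁅ suc (suc i) ⁆ ∪_) (ancestorsUpTo-rootExtension k (parent T i) (≤-trans (parent-< T i) i≤k))

  rootPath-rootExtension : ∀ v → rootPath (rootExtension T) (suc v) ≡ inside ∷ rootPath T v
  rootPath-rootExtension v = ancestorsUpTo-rootExtension (edges T) v (≤-pred (Finₚ.toℕ<n v))

⊥++⊥ : ∀ a b → ⊥ {a} ++ ⊥ {b} ≡ ⊥
⊥++⊥ zero    b = refl
⊥++⊥ (suc a) b = cong (outside ∷_) (⊥++⊥ a b)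

⁅v↑ˡ⁆ : ∀ {a} (v : Fin a) b → ⁅ v ↑ˡ b ⁆ ≡ ⁅ v ⁆ ++ ⊥ {b}
⁅v↑ˡ⁆ {suc a} zero    b = cong (inside ∷_) (sym (⊥++⊥ a b))
⁅v↑ˡ⁆         (suc v) b = cong (outside ∷_) (⁅v↑ˡ⁆ v b)

⁅↑ʳv⁆ : ∀ a {b} (v : Fin b) → ⁅ a ↑ʳ v ⁆ ≡ ⊥ {a} ++ ⁅ v ⁆
⁅↑ʳv⁆ zero    v = refl
⁅↑ʳv⁆ (suc a) v = cong (outside ∷_) (⁅↑ʳv⁆ a v)

∣p++q∣ : ∀ {a b} (p : Subset a) (q : Subset b) → ∣ p ++ q ∣ ≡ ∣ p ∣ + ∣ q ∣
∣p++q∣ []            q = refl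
∣p++q∣ (inside ∷ p)  q = cong suc (∣p++q∣ p q)
∣p++q∣ (outside ∷ p) q = ∣p++q∣ p q

∈p++q⁺ˡ : ∀ {a b} (p : Subset a) (q : Subset b) {v} → v ∈ p → (v ↑ˡ b) ∈ p ++ q
∈p++q⁺ˡ (s ∷ p) q here       = here
∈p++q⁺ˡ (s ∷ p) q (there v∈) = there (∈p++q⁺ˡ p q v∈)

∈p++q⁺ʳ : ∀ {a b} (p : Subset a) (q : Subset b) {v} → v ∈ q → (a ↑ʳ v) ∈ p ++ q
∈p++q⁺ʳ []      q v∈ = v∈
∈p++q⁺ʳ (s ∷ p) q v∈ = there (∈p++q⁺ʳ p q v∈)

∈p++q⁻ : ∀ {a b} (p : Subset a) (q : Subset b) {j} → j ∈ p ++ q →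
         (∃ λ i → i ↑ˡ b ≡ j × i ∈ p) ⊎ (∃ λ i → a ↑ʳ i ≡ j × i ∈ q)
∈p++q⁻ []      q j∈       = inj₂ (_ , refl , j∈)
∈p++q⁻ (s ∷ p) q here     = inj₁ (zero , refl , here)
∈p++q⁻ (s ∷ p) q (there j∈) with ∈p++q⁻ p q j∈
... | inj₁ (i , refl , i∈) = inj₁ (suc i , refl , there i∈)
... | inj₂ (i , refl , i∈) = inj₂ (i , refl , i∈)

-- The wedge of two rooted trees identifies their roots.  Vertex v of T₁
-- becomes v ↑ˡ e₂, and the non-root vertices of T₂ are numbered after
-- those of T₁, which keeps parents below their children.
module Wedge (T₁ T₂ : RootedTree) where
  e₁ = edges T₁
  e₂ = edges T₂

  vertex₂ : Fin (suc e₂) → Fin (suc (e₁ + e₂))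
  vertex₂ zero    = zero
  vertex₂ (suc k) = suc (e₁ ↑ʳ k)

  wedgeParent : Fin (e₁ + e₂) → Fin (suc (e₁ + e₂))
  wedgeParent j = [ (λ i → parent T₁ i ↑ˡ e₂) , (λ i → vertex₂ (parent T₂ i)) ]′ (splitAt e₁ j)

  wedgeParent-↑ˡ : ∀ i → wedgeParent (i ↑ˡ e₂) ≡ parent T₁ i ↑ˡ e₂
  wedgeParent-↑ˡ i = cong [ _ , _ ]′ (Finₚ.splitAt-↑ˡ e₁ i e₂)

  wedgeParent-↑ʳ : ∀ i → wedgeParent (e₁ ↑ʳ i) ≡ vertex₂ (parent T₂ i)
  wedgeParent-↑ʳ i = cong [ _ , _ ]′ (Finₚ.splitAt-↑ʳ e₁ e₂ i)

  edge-view : ∀ j → (∃ λ i → i ↑ˡ e₂ ≡ j) ⊎ (∃ λ i → e₁ ↑ʳ i ≡ j)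
  edge-view j with splitAt e₁ j in eq
  ... | inj₁ i = inj₁ (i , Finₚ.splitAt⁻¹-↑ˡ eq)
  ... | inj₂ i = inj₂ (i , Finₚ.splitAt⁻¹-↑ʳ eq)

  toℕ-vertex₂ : ∀ v → toℕ (vertex₂ v) ≤ e₁ + toℕ v
  toℕ-vertex₂ zero    = z≤n
  toℕ-vertex₂ (suc k) = ≤-reflexive (trans (cong suc (Finₚ.toℕ-↑ʳ e₁ k)) (sym (+-suc e₁ _)))

  vertex₂-injective : ∀ {v w} → vertex₂ v ≡ vertex₂ w → v ≡ w
  vertex₂-injective {zero}  {zero}  _ = refl
  vertex₂-injective {suc v} {suc w} e = cong suc (Finₚ.↑ʳ-injective e₁ v w (Finₚ.suc-injective e))

  wedgeParent-< : ∀ j → toℕ (wedgeParent j) ≤ toℕ j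
  wedgeParent-< j with edge-view j
  ... | inj₁ (i , refl) = begin
    toℕ (wedgeParent (i ↑ˡ e₂)) ≡⟨ cong toℕ (wedgeParent-↑ˡ i) ⟩
    toℕ (parent T₁ i ↑ˡ e₂)     ≡⟨ Finₚ.toℕ-↑ˡ (parent T₁ i) e₂ ⟩
    toℕ (parent T₁ i)           ≤⟨ parent-< T₁ i ⟩
    toℕ i                       ≡⟨ sym (Finₚ.toℕ-↑ˡ i e₂) ⟩
    toℕ (i ↑ˡ e₂)               ∎
    where open ≤-Reasoning
  ... | inj₂ (i , refl) = begin
    toℕ (wedgeParent (e₁ ↑ʳ i))  ≡⟨ cong toℕ (wedgeParent-↑ʳ i) ⟩
    toℕ (vertex₂ (parent T₂ i))  ≤⟨ toℕ-vertex₂ (parent T₂ i) ⟩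
    e₁ + toℕ (parent T₂ i)       ≤⟨ +-monoʳ-≤ e₁ (parent-< T₂ i) ⟩
    e₁ + toℕ i                   ≡⟨ sym (Finₚ.toℕ-↑ʳ e₁ i) ⟩
    toℕ (e₁ ↑ʳ i)                ∎
    where open ≤-Reasoning

  wedge : RootedTree
  wedge = record { edges = e₁ + e₂ ; parent = wedgeParent ; parent-< = wedgeParent-< }

  lift₁ : Subset (suc e₁) → Subset (suc (e₁ + e₂))
  lift₁ A = A ++ ⊥

  lift₂ : Subset (suc e₂) → Subset (suc (e₁ + e₂))
  lift₂ (b ∷ B) = b ∷ (⊥ {e₁} ++ B)

  lift₁-∪ : ∀ A C → lift₁ A ∪ lift₁ C ≡ lift₁ (A ∪ C)
  lift₁-∪ A C = trans (zipWith-++ _ A ⊥ C ⊥) (cong ((A ∪ C) ++_) (∪-identityʳ ⊥))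

  lift₂-∪ : ∀ A C → lift₂ A ∪ lift₂ C ≡ lift₂ (A ∪ C)
  lift₂-∪ (a ∷ A) (c ∷ C) = cong (_ ∷_) (trans (zipWith-++ _ ⊥ A ⊥ C) (cong (_++ (A ∪ C)) (∪-identityʳ ⊥)))

  lift₂-⁅⁆ : ∀ v → ⁅ vertex₂ v ⁆ ≡ lift₂ ⁅ v ⁆
  lift₂-⁅⁆ zero    = cong (inside ∷_) (sym (⊥++⊥ e₁ e₂))
  lift₂-⁅⁆ (suc k) = cong (outside ∷_) (⁅↑ʳv⁆ e₁ k)

  ancestorsUpTo-wedge₁ : ∀ k v → ancestorsUpTo wedge k (v ↑ˡ e₂) ≡ lift₁ (ancestorsUpTo T₁ k v)
  ancestorsUpTo-wedge₁ zero    v       = ⁅v↑ˡ⁆ v e₂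
  ancestorsUpTo-wedge₁ (suc k) zero    = ⁅v↑ˡ⁆ {suc e₁} zero e₂
  ancestorsUpTo-wedge₁ (suc k) (suc i) = begin
    ⁅ suc i ↑ˡ e₂ ⁆ ∪ ancestorsUpTo wedge k (wedgeParent (i ↑ˡ e₂))
      ≡⟨ cong (λ w → ⁅ suc i ↑ˡ e₂ ⁆ ∪ ancestorsUpTo wedge k w) (wedgeParent-↑ˡ i) ⟩
    ⁅ suc i ↑ˡ e₂ ⁆ ∪ ancestorsUpTo wedge k (parent T₁ i ↑ˡ e₂)
      ≡⟨ cong₂ _∪_ (⁅v↑ˡ⁆ (suc i) e₂) (ancestorsUpTo-wedge₁ k (parent T₁ i)) ⟩
    lift₁ ⁅ suc i ⁆ ∪ lift₁ (ancestorsUpTo T₁ k (parent T₁ i))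
      ≡⟨ lift₁-∪ _ _ ⟩
    lift₁ (⁅ suc i ⁆ ∪ ancestorsUpTo T₁ k (parent T₁ i)) ∎
    where open ≡-Reasoning

  ancestorsUpTo-wedge₂ : ∀ k v → ancestorsUpTo wedge k (vertex₂ v) ≡ lift₂ (ancestorsUpTo T₂ k v)
  ancestorsUpTo-wedge₂ zero    v       = lift₂-⁅⁆ v
  ancestorsUpTo-wedge₂ (suc k) zero    = lift₂-⁅⁆ zero
  ancestorsUpTo-wedge₂ (suc k) (suc i) = begin
    ⁅ vertex₂ (suc i) ⁆ ∪ ancestorsUpTo wedge k (wedgeParent (e₁ ↑ʳ i))
      ≡⟨ cong (λ w → ⁅ vertex₂ (suc i) ⁆ ∪ ancestorsUpTo wedge k w) (wedgeParent-↑ʳ i) ⟩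
    ⁅ vertex₂ (suc i) ⁆ ∪ ancestorsUpTo wedge k (vertex₂ (parent T₂ i))
      ≡⟨ cong₂ _∪_ (lift₂-⁅⁆ (suc i)) (ancestorsUpTo-wedge₂ k (parent T₂ i)) ⟩
    lift₂ ⁅ suc i ⁆ ∪ lift₂ (ancestorsUpTo T₂ k (parent T₂ i))
      ≡⟨ lift₂-∪ _ _ ⟩
    lift₂ (⁅ suc i ⁆ ∪ ancestorsUpTo T₂ k (parent T₂ i)) ∎
    where open ≡-Reasoning

  rootPath-wedge₁ : ∀ v → rootPath wedge (v ↑ˡ e₂) ≡ lift₁ (rootPath T₁ v)
  rootPath-wedge₁ v = trans (ancestorsUpTo-wedge₁ (e₁ + e₂) v)
    (cong lift₁ (sym (TreeProperties.rootPath-ancestorsUpTo T₁ (e₁ + e₂) v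
                        (≤-trans (≤-pred (Finₚ.toℕ<n v)) (m≤m+n e₁ e₂)))))

  rootPath-wedge₂ : ∀ v → rootPath wedge (vertex₂ v) ≡ lift₂ (rootPath T₂ v)
  rootPath-wedge₂ v = trans (ancestorsUpTo-wedge₂ (e₁ + e₂) v)
    (cong lift₂ (sym (TreeProperties.rootPath-ancestorsUpTo T₂ (e₁ + e₂) v
                        (≤-trans (≤-pred (Finₚ.toℕ<n v)) (m≤n+m e₂ e₁)))))

  ∣lift₁∣ : ∀ A → ∣ lift₁ A ∣ ≡ ∣ A ∣
  ∣lift₁∣ A = trans (∣p++q∣ A ⊥) (trans (cong (∣ A ∣ +_) (∣⊥∣≡0 e₂)) (+-identityʳ _))

  ∣lift₂∣ : ∀ A → ∣ lift₂ A ∣ ≡ ∣ A ∣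
  ∣lift₂∣ (inside ∷ A)  = cong suc (trans (∣p++q∣ (⊥ {e₁}) A) (cong (_+ ∣ A ∣) (∣⊥∣≡0 e₁)))
  ∣lift₂∣ (outside ∷ A) = trans (∣p++q∣ (⊥ {e₁}) A) (cong (_+ ∣ A ∣) (∣⊥∣≡0 e₁))

  ∈lift₂⁺ : ∀ B {i} → suc i ∈ B → suc (e₁ ↑ʳ i) ∈ lift₂ B
  ∈lift₂⁺ (b ∷ B) (there i∈) = there (∈p++q⁺ʳ ⊥ B i∈)

  wedge-leaf₁ : ∀ {w} → IsLeaf T₁ (suc w) → IsLeaf wedge (suc w ↑ˡ e₂)
  wedge-leaf₁ {w} leaf j parent≡ with edge-view j
  ... | inj₁ (i , refl) = leaf i (Finₚ.↑ˡ-injective e₂ _ _ (trans (sym (wedgeParent-↑ˡ i)) parent≡))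
  ... | inj₂ (i , refl) = <⇒≢ (toℕ-↑ˡ<toℕ-vertex₂ (parent T₂ i) nonroot) (cong toℕ (sym vertex₂≡))
    where
    vertex₂≡ : vertex₂ (parent T₂ i) ≡ suc w ↑ˡ e₂
    vertex₂≡ = trans (sym (wedgeParent-↑ʳ i)) parent≡
    nonroot : parent T₂ i ≢ zero
    nonroot p≡0 = contradiction (trans (sym (cong vertex₂ p≡0)) vertex₂≡) λ ()
    toℕ-↑ˡ<toℕ-vertex₂ : ∀ v → v ≢ zero → toℕ (suc w ↑ˡ e₂) < toℕ (vertex₂ v)
    toℕ-↑ˡ<toℕ-vertex₂ zero    v≢0 = contradiction refl v≢0
    toℕ-↑ˡ<toℕ-vertex₂ (suc k) _   = s≤s (subst₂ _<_ (sym (Finₚ.toℕ-↑ˡ w e₂)) (sym (Finₚ.toℕ-↑ʳ e₁ k))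
                                        (≤-trans (Finₚ.toℕ<n w) (m≤m+n e₁ _)))

  wedge-leaf₂ : ∀ {w} → IsLeaf T₂ (suc w) → IsLeaf wedge (vertex₂ (suc w))
  wedge-leaf₂ {w} leaf j parent≡ with edge-view j
  ... | inj₂ (i , refl) = leaf i (vertex₂-injective (trans (sym (wedgeParent-↑ʳ i)) parent≡))
  ... | inj₁ (i , refl) = <⇒≢ parent<w (cong toℕ (trans (sym (wedgeParent-↑ˡ i)) parent≡))
    where
    parent<w : toℕ (parent T₁ i ↑ˡ e₂) < toℕ (suc (e₁ ↑ʳ w))
    parent<w = begin-strict
      toℕ (parent T₁ i ↑ˡ e₂) ≡⟨ Finₚ.toℕ-↑ˡ (parent T₁ i) e₂ ⟩
      toℕ (parent T₁ i)       ≤⟨ parent-< T₁ i ⟩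
      toℕ i                   <⟨ Finₚ.toℕ<n i ⟩
      e₁                      ≤⟨ m≤m+n e₁ _ ⟩
      e₁ + toℕ w              <⟨ ≤-refl ⟩
      suc (e₁ + toℕ w)        ≡⟨ cong suc (sym (Finₚ.toℕ-↑ʳ e₁ w)) ⟩
      toℕ (suc (e₁ ↑ʳ w))     ∎
      where open ≤-Reasoning

-- Decompositions

HasDecompositionOfHeight : Matroid n → ℕ → Set
HasDecompositionOfHeight M h = ∃ λ (D : Decomposition M) → HeightAtMost (tree D) h

path≤edgesOfUnionOfPaths : ∀ T (f : Fin n → Fin (suc (edges T))) {X x} → x ∈ X →
                           ∣ tail (rootPath T (f x)) ∣ ≤ edgesOfUnionOfPaths T f X
path≤edgesOfUnionOfPaths T f {X} x∈X = ∣tail∣-mono (∈unionOver⁺ X (rootPath T ∘ f) x∈X)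

∣p∣≡1+∣tail-p∣ : ∀ {m} (p : Subset (suc m)) → zero ∈ p → ∣ p ∣ ≡ suc ∣ tail p ∣
∣p∣≡1+∣tail-p∣ (inside ∷ p) here = refl

rank-bound-rootExtension : ∀ T (f : Fin n → Fin (suc (edges T))) {X} → Nonempty X →
  suc (edgesOfUnionOfPaths T f X) ≤ edgesOfUnionOfPaths (rootExtension T) (λ x → suc (f x)) X
rank-bound-rootExtension T f {X} (x , x∈X) = begin
  suc ∣ tail paths ∣  ≡⟨ sym (∣p∣≡1+∣tail-p∣ paths root∈paths) ⟩
  ∣ paths ∣           ≤⟨ p⊆q⇒∣p∣≤∣q∣ (∈tail⁺ paths′ ∘ lift) ⟩
  ∣ tail paths′ ∣     ∎
  where
  open ≤-Reasoning
  paths  = unionOver X (rootPath T ∘ f)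
  paths′ = unionOver X (λ x → rootPath (rootExtension T) (suc (f x)))
  root∈paths : zero ∈ paths
  root∈paths = ∈unionOver⁺ X _ x∈X (TreeProperties.root∈rootPath T (f x))
  lift : ∀ {v} → v ∈ paths → suc v ∈ paths′
  lift v∈ with ∈unionOver⁻ X (rootPath T ∘ f) v∈
  ... | y , y∈X , v∈path =
    ∈unionOver⁺ X _ y∈X (subst (suc _ ∈_) (sym (rootPath-rootExtension T (f y))) (there v∈path))

-- A decomposition of M|U, indexed by the whole ground set (elements
-- outside U are mapped anywhere).
record PartialDecomposition (M : Matroid n) (U : Subset n) (h : ℕ) : Set where
  field
    tree         : RootedTree
    leafMap      : Fin n → Fin (suc (edges tree))
    leafMap-leaf : ∀ x → x ∈ U → IsLeaf tree (leafMap x)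
    edges≡rank   : edges tree ≡ rank M U
    rank-bound   : ∀ X → X ⊆ U → rank M X ≤ edgesOfUnionOfPaths tree leafMap X
    height       : HeightAtMost tree h

module PD = PartialDecomposition

module _ (M : Matroid n) where
  open RankProperties M

  PartialDecomposition-⊤ : ∀ {h} → PartialDecomposition M ⊤ h → HasDecompositionOfHeight M h
  PartialDecomposition-⊤ P =
    record { tree = PD.tree P ; leafMap = PD.leafMap P ; leafMap-leaf = λ x → PD.leafMap-leaf P x ∈⊤
           ; edges≡rank = PD.edges≡rank P ; rank-bound = λ X → PD.rank-bound P X ⊆⊤ }
    , PD.height P

  trivialDecomposition : ∀ {U h} → rank M U ≡ 0 → 1 ≤ h → PartialDecomposition M U h
  trivialDecomposition {U} rank≡0 1≤h = record
    { tree         = trivialTree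
    ; leafMap      = λ _ → zero
    ; leafMap-leaf = λ _ _ ()
    ; edges≡rank   = sym rank≡0
    ; rank-bound   = λ X X⊆U → ≤-trans (mono X⊆U) (≤-trans (≤-reflexive rank≡0) z≤n)
    ; height       = λ v _ → ≤-trans (∣p∣≤n (rootPath trivialTree v)) 1≤h
    }

  singleEdgeDecomposition : ∀ {U h} → rank M U ≡ 1 → 2 ≤ h → PartialDecomposition M U h
  singleEdgeDecomposition {U} rank≡1 2≤h = record
    { tree         = singleEdgeTree
    ; leafMap      = λ _ → suc zero
    ; leafMap-leaf = λ _ _ _ ()
    ; edges≡rank   = sym rank≡1
    ; rank-bound   = bound
    ; height       = λ v _ → ≤-trans (∣p∣≤n (rootPath singleEdgeTree v)) 2≤h
    }
    where
    bound : ∀ X → X ⊆ U → rank M X ≤ edgesOfUnionOfPaths singleEdgeTree (λ _ → suc zero) X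
    bound X X⊆U with nonempty? X
    ... | yes (x , x∈X) = ≤-trans (mono X⊆U) (≤-trans (≤-reflexive rank≡1)
                            (path≤edgesOfUnionOfPaths singleEdgeTree (λ _ → suc zero) x∈X))
    ... | no X-empty    = ≤-trans (≤-reflexive (rank-Empty X-empty)) z≤n

  rootExtensionDecomposition : ∀ {h} (M′ : Matroid n) → HasDecompositionOfHeight M′ h →
    rank M ⊤ ≡ suc (rank M′ ⊤) → (∀ X → rank M X ≤ suc (rank M′ X)) → HasDecompositionOfHeight M (suc h)
  rootExtensionDecomposition {h} M′ (D′ , height′) rank⊤≡ rank≤ = D , height
    where
    T = tree D′
    f = leafMap D′
    f′ : Fin n → Fin (suc (edges (rootExtension T)))
    f′ x = suc (f x)
    leaf : ∀ x → IsLeaf (rootExtension T) (f′ x)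
    leaf x zero    ()
    leaf x (suc i) parent≡ = leafMap-leaf D′ x i (Finₚ.suc-injective parent≡)
    bound : ∀ X → rank M X ≤ edgesOfUnionOfPaths (rootExtension T) f′ X
    bound X with nonempty? X
    ... | yes X≢∅ = ≤-trans (rank≤ X) (≤-trans (s≤s (rank-bound D′ X)) (rank-bound-rootExtension T f X≢∅))
    ... | no X-empty = ≤-trans (≤-reflexive (rank-Empty X-empty)) z≤n
    D : Decomposition M
    D = record { tree = rootExtension T ; leafMap = f′ ; leafMap-leaf = leaf
               ; edges≡rank = trans (cong suc (edges≡rank D′)) (sym rank⊤≡) ; rank-bound = bound }
    height : HeightAtMost (rootExtension T) (suc h)
    height zero    root-leaf = contradiction refl (root-leaf zero)
    height (suc w) w-leaf    = subst (λ P → ∣ P ∣ ≤ suc h) (sym (rootPath-rootExtension T w))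
                                     (s≤s (height′ w (λ i e → w-leaf (suc i) (cong suc e))))

  restrictionDecomposition : ∀ S {h} → HasDecompositionOfHeight (restriction M S) h → PartialDecomposition M S h
  restrictionDecomposition S {h} (D , height) = record
    { tree         = T
    ; leafMap      = f
    ; leafMap-leaf = leaf
    ; edges≡rank   = trans (edges≡rank D) (cong (rank M) (image-⊤ S))
    ; rank-bound   = bound
    ; height       = height
    }
    where
    T = tree D
    f : Fin n → Fin (suc (edges T))
    f = extendAlong S zero (leafMap D)
    leaf : ∀ x → x ∈ S → IsLeaf T (f x)
    leaf x x∈S with embed-surjective S x∈S
    ... | i , refl = subst (IsLeaf T) (sym (extendAlong-embed S zero (leafMap D) i)) (leafMap-leaf D i)
    bound : ∀ X → X ⊆ S → rank M X ≤ edgesOfUnionOfPaths T f X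
    bound X X⊆S = begin
      rank M X                                          ≡⟨ cong (rank M) (sym (image-preimage S X⊆S)) ⟩
      rank M (image S (preimage S X))                   ≤⟨ rank-bound D (preimage S X) ⟩
      edgesOfUnionOfPaths T (leafMap D) (preimage S X)  ≤⟨ edgesOfUnionOfPaths-mono T (λ {i} i∈ →
                                                             embed S i , ∈preimage⁻ S X i∈ ,
                                                             sym (extendAlong-embed S zero (leafMap D) i)) ⟩
      edgesOfUnionOfPaths T f X                         ∎
      where open ≤-Reasoning

  absorbRankZero : ∀ {U₁ U₂ h} → rank M U₁ ≡ 0 → PartialDecomposition M U₂ h → PartialDecomposition M (U₁ ∪ U₂) h
  absorbRankZero {U₁} {U₂} rank≡0 P = record
    { tree         = T
    ; leafMap      = f
    ; leafMap-leaf = leaf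
    ; edges≡rank   = trans (PD.edges≡rank P) (≤-antisym (mono (q⊆p∪q U₁ U₂)) rank-U₁∪U₂≤)
    ; rank-bound   = bound
    ; height       = PD.height P
    }
    where
    open ≤-Reasoning
    T = PD.tree P
    f : Fin n → Fin (suc (edges T))
    f x with x ∈? U₂
    ... | yes _ = PD.leafMap P x
    ... | no _  = TreeProperties.lastVertex T
    f-U₂ : ∀ {x} → x ∈ U₂ → f x ≡ PD.leafMap P x
    f-U₂ {x} x∈U₂ with x ∈? U₂
    ... | yes _    = refl
    ... | no x∉U₂ = contradiction x∈U₂ x∉U₂
    leaf : ∀ x → x ∈ U₁ ∪ U₂ → IsLeaf T (f x)
    leaf x _ with x ∈? U₂
    ... | yes x∈U₂ = PD.leafMap-leaf P x x∈U₂
    ... | no _     = TreeProperties.lastVertex-leaf T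
    rank-U₁∪U₂≤ : rank M (U₁ ∪ U₂) ≤ rank M U₂
    rank-U₁∪U₂≤ = begin
      rank M (U₁ ∪ U₂)      ≤⟨ subadditive U₁ U₂ (λ x∈ → x∈) ⟩
      rank M U₁ + rank M U₂ ≡⟨ cong (_+ rank M U₂) rank≡0 ⟩
      rank M U₂             ∎
    bound : ∀ X → X ⊆ U₁ ∪ U₂ → rank M X ≤ edgesOfUnionOfPaths T f X
    bound X X⊆U₁∪U₂ = begin
      rank M X                                   ≤⟨ subadditive (X ─ U₂) (X ∩ U₂) X-split ⟩
      rank M (X ─ U₂) + rank M (X ∩ U₂)           ≤⟨ +-monoˡ-≤ _ (≤-trans (mono X─U₂⊆U₁) (≤-reflexive rank≡0)) ⟩
      rank M (X ∩ U₂)                            ≤⟨ PD.rank-bound P (X ∩ U₂) (p∩q⊆q X U₂) ⟩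
      edgesOfUnionOfPaths T (PD.leafMap P) (X ∩ U₂) ≤⟨ edgesOfUnionOfPaths-mono T (λ {x} x∈ →
                                                       let (x∈X , x∈U₂) = x∈p∩q⁻ X U₂ x∈ in x , x∈X , sym (f-U₂ x∈U₂)) ⟩
      edgesOfUnionOfPaths T f X                  ∎
      where
      X-split : X ⊆ (X ─ U₂) ∪ (X ∩ U₂)
      X-split x∈X = [ q⊆p∪q (X ─ U₂) _ , p⊆p∪q _ ]′ (x∈p∪q⁻ _ _ (p⊆p∩q∪p─q X U₂ x∈X))
      X─U₂⊆U₁ : X ─ U₂ ⊆ U₁
      X─U₂⊆U₁ x∈ = let (x∈X , x∉U₂) = x∈p─q⁻ X U₂ x∈ in
        x∈p∪q∧x∉p⇒x∈q (subst (_ ∈_) (∪-comm U₁ U₂) (X⊆U₁∪U₂ x∈X)) x∉U₂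

  wedgeDecomposition : ∀ {U₁ U₂ h} (P₁ : PartialDecomposition M U₁ h) (P₂ : PartialDecomposition M U₂ h) →
    Fin (edges (PD.tree P₁)) → Fin (edges (PD.tree P₂)) →
    rank M (U₁ ∪ U₂) ≡ rank M U₁ + rank M U₂ → PartialDecomposition M (U₁ ∪ U₂) h
  wedgeDecomposition {U₁} {U₂} {h} P₁ P₂ edge₁ edge₂ additive = record
    { tree         = wedge
    ; leafMap      = f
    ; leafMap-leaf = leaf
    ; edges≡rank   = trans (cong₂ _+_ (PD.edges≡rank P₁) (PD.edges≡rank P₂)) (sym additive)
    ; rank-bound   = bound
    ; height       = height
    }
    where
    T₁ = PD.tree P₁
    T₂ = PD.tree P₂
    f₁ = PD.leafMap P₁
    f₂ = PD.leafMap P₂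
    open Wedge T₁ T₂
    f : Fin n → Fin (suc (e₁ + e₂))
    f x with x ∈? U₁
    ... | yes _ = f₁ x ↑ˡ e₂
    ... | no _  = vertex₂ (f₂ x)
    f-U₁ : ∀ {x} → x ∈ U₁ → f x ≡ f₁ x ↑ˡ e₂
    f-U₁ {x} x∈U₁ with x ∈? U₁
    ... | yes _    = refl
    ... | no x∉U₁ = contradiction x∈U₁ x∉U₁
    f-U₂ : ∀ {x} → x ∉ U₁ → f x ≡ vertex₂ (f₂ x)
    f-U₂ {x} x∉U₁ with x ∈? U₁
    ... | yes x∈U₁ = contradiction x∈U₁ x∉U₁
    ... | no _     = refl

    leaf : ∀ x → x ∈ U₁ ∪ U₂ → IsLeaf wedge (f x)
    leaf x x∈ with x ∈? U₁
    ... | yes x∈U₁ with PD.leafMap-leaf P₁ x x∈U₁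
    ...   | f₁x-leaf with TreeProperties.leaf⇒suc T₁ edge₁ f₁x-leaf
    ...     | w , f₁x≡ = subst (λ v → IsLeaf wedge (v ↑ˡ e₂)) (sym f₁x≡) (wedge-leaf₁ (subst (IsLeaf T₁) f₁x≡ f₁x-leaf))
    leaf x x∈ | no x∉U₁ with PD.leafMap-leaf P₂ x (x∈p∪q∧x∉p⇒x∈q x∈ x∉U₁)
    ...   | f₂x-leaf with TreeProperties.leaf⇒suc T₂ edge₂ f₂x-leaf
    ...     | w , f₂x≡ = subst (λ v → IsLeaf wedge (vertex₂ v)) (sym f₂x≡) (wedge-leaf₂ (subst (IsLeaf T₂) f₂x≡ f₂x-leaf))

    bound : ∀ X → X ⊆ U₁ ∪ U₂ → rank M X ≤ edgesOfUnionOfPaths wedge f X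
    bound X X⊆U₁∪U₂ = begin
      rank M X                          ≤⟨ subadditive (X ∩ U₁) (X ─ U₁) (p⊆p∩q∪p─q X U₁) ⟩
      rank M (X ∩ U₁) + rank M (X ─ U₁) ≤⟨ +-mono-≤ (PD.rank-bound P₁ _ (p∩q⊆q X U₁)) (PD.rank-bound P₂ _ X─U₁⊆U₂) ⟩
      ∣ tail A₁ ∣ + ∣ tail A₂ ∣          ≡⟨ sym (∣p++q∣ (tail A₁) (tail A₂)) ⟩
      ∣ tail A₁ ++ tail A₂ ∣            ≤⟨ p⊆q⇒∣p∣≤∣q∣ A₁++A₂⊆A ⟩
      ∣ tail A ∣                        ∎
      where
      open ≤-Reasoning
      A₁ = unionOver (X ∩ U₁) (rootPath T₁ ∘ f₁)
      A₂ = unionOver (X ─ U₁) (rootPath T₂ ∘ f₂)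
      A  = unionOver X (rootPath wedge ∘ f)
      X─U₁⊆U₂ : X ─ U₁ ⊆ U₂
      X─U₁⊆U₂ x∈ = let (x∈X , x∉U₁) = x∈p─q⁻ X U₁ x∈ in x∈p∪q∧x∉p⇒x∈q (X⊆U₁∪U₂ x∈X) x∉U₁
      A₁++A₂⊆A : tail A₁ ++ tail A₂ ⊆ tail A
      A₁++A₂⊆A v∈ with ∈p++q⁻ (tail A₁) (tail A₂) v∈
      ... | inj₁ (i , refl , i∈) with ∈unionOver⁻ (X ∩ U₁) _ (∈tail⁻ A₁ i∈)
      ...   | x , x∈ , i∈path = let (x∈X , x∈U₁) = x∈p∩q⁻ X U₁ x∈ in
        ∈tail⁺ A (∈unionOver⁺ X _ x∈X (subst (suc i ↑ˡ e₂ ∈_)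
          (sym (trans (cong (rootPath wedge) (f-U₁ x∈U₁)) (rootPath-wedge₁ (f₁ x))))
          (∈p++q⁺ˡ _ ⊥ i∈path)))
      A₁++A₂⊆A v∈ | inj₂ (i , refl , i∈) with ∈unionOver⁻ (X ─ U₁) _ (∈tail⁻ A₂ i∈)
      ...   | x , x∈ , i∈path = let (x∈X , x∉U₁) = x∈p─q⁻ X U₁ x∈ in
        ∈tail⁺ A (∈unionOver⁺ X _ x∈X (subst (suc (e₁ ↑ʳ i) ∈_)
          (sym (trans (cong (rootPath wedge) (f-U₂ x∉U₁)) (rootPath-wedge₂ (f₂ x))))
          (∈lift₂⁺ _ i∈path)))

    height : HeightAtMost wedge h
    height zero root-leaf = contradiction root-leaf (TreeProperties.root-not-leaf wedge (edge₁ ↑ˡ e₂))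
    height (suc j) j-leaf with edge-view j
    ... | inj₁ (i , refl) = subst (λ P → ∣ P ∣ ≤ h) (sym (rootPath-wedge₁ (suc i)))
      (≤-trans (≤-reflexive (∣lift₁∣ (rootPath T₁ (suc i))))
               (PD.height P₁ (suc i) λ i′ e → j-leaf (i′ ↑ˡ e₂) (trans (wedgeParent-↑ˡ i′) (cong (_↑ˡ e₂) e))))
    ... | inj₂ (i , refl) = subst (λ P → ∣ P ∣ ≤ h) (sym (rootPath-wedge₂ (suc i)))
      (≤-trans (≤-reflexive (∣lift₂∣ (rootPath T₂ (suc i))))
               (PD.height P₂ (suc i) λ i′ e → j-leaf (e₁ ↑ʳ i′) (trans (wedgeParent-↑ʳ i′) (cong vertex₂ e))))

  glueDecompositions : ∀ {U₁ U₂ h} → PartialDecomposition M U₁ h → PartialDecomposition M U₂ h →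
    rank M (U₁ ∪ U₂) ≡ rank M U₁ + rank M U₂ → PartialDecomposition M (U₁ ∪ U₂) h
  glueDecompositions {U₁} {U₂} {h} P₁ P₂ additive with edges (PD.tree P₁) in e₁≡ | edges (PD.tree P₂) in e₂≡
  ... | zero  | _     = absorbRankZero (trans (sym (PD.edges≡rank P₁)) e₁≡) P₂
  ... | suc _ | zero  = subst (λ U → PartialDecomposition M U h) (∪-comm U₂ U₁)
                              (absorbRankZero (trans (sym (PD.edges≡rank P₂)) e₂≡) P₁)
  ... | suc _ | suc _ = wedgeDecomposition P₁ P₂ (subst Fin (sym e₁≡) zero) (subst Fin (sym e₂≡) zero) additive

module _ (M : Matroid n) where
  open RankProperties M
  open ComponentProperties M

  unionOfComponentsDecomposition : ∀ {h} → 1 ≤ h → (∀ x → PartialDecomposition M (component x) h) →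
    ∀ U → (∀ {y} → y ∈ U → component y ⊆ U) → PartialDecomposition M U h
  unionOfComponentsDecomposition {h} 1≤h decompose = ⊂-rec Goal step
    where
    Goal : Subset n → Set
    Goal U = (∀ {y} → y ∈ U → component y ⊆ U) → PartialDecomposition M U h
    step : ∀ U → (∀ {V} → V ⊂ U → Goal V) → Goal U
    step U rec closed with nonempty? U
    ... | no U-empty = trivialDecomposition M (rank-Empty U-empty) 1≤h
    ... | yes (x , x∈U) =
      subst (λ V → PartialDecomposition M V h) K∪U′≡U (glueDecompositions M (decompose x) (rec U′⊂U U′-closed) additive)
      where
      K  = component x
      U′ = U ─ K
      U′⊂U : U′ ⊂ U
      U′⊂U = p∩q≢∅⇒p─q⊂p U K (x , x∈p∩q⁺ (x∈U , x∈component x))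
      U′-closed : ∀ {y} → y ∈ U′ → component y ⊆ U′
      U′-closed y∈U′ z∈ = let (y∈U , y∉K) = x∈p─q⁻ U K y∈U′ in
        x∈p∧x∉q⇒x∈p─q (closed y∈U z∈) (λ z∈K → y∉K (component-⊆ z∈K (∈component⁺ (∼-sym (∈component⁻ z∈)))))
      K∪U′≡U : K ∪ U′ ≡ U
      K∪U′≡U = ⊆-antisym (∪-least (closed x∈U) (p─q⊆p U K))
        (λ y∈U → [ p⊆p∪q U′ ∘ p∩q⊆q U K , q⊆p∪q K U′ ]′ (x∈p∪q⁻ _ _ (p⊆p∩q∪p─q U K y∈U)))
      U∩K≡K : U ∩ K ≡ K
      U∩K≡K = ⊆-antisym (p∩q⊆q U K) (λ y∈K → x∈p∩q⁺ (closed x∈U y∈K , y∈K))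
      additive : rank M (K ∪ U′) ≡ rank M K + rank M U′
      additive = begin
        rank M (K ∪ U′)                ≡⟨ cong (rank M) K∪U′≡U ⟩
        rank M U                       ≡⟨ separator-additive (component-separator x) U ⟩
        rank M (U ∩ K) + rank M U′     ≡⟨ cong (λ V → rank M V + rank M U′) U∩K≡K ⟩
        rank M K + rank M U′           ∎
        where open ≡-Reasoning

  componentsDecomposition : ∀ {h} → 1 ≤ h → (∀ x → PartialDecomposition M (component x) h) →
                            HasDecompositionOfHeight M h
  componentsDecomposition 1≤h decompose =
    PartialDecomposition-⊤ M (unionOfComponentsDecomposition 1≤h decompose ⊤ (λ _ → ⊆⊤))

-- c*-transformations

NonLoopNonColoop⊎AllLoops : Matroid n → Set
NonLoopNonColoop⊎AllLoops {n} M = (∃ λ (x : Fin n) → ¬ Loop M x × ¬ Coloop M x) ⊎ (∀ (x : Fin n) → Loop M x)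

-- e = zero is the extra element of M⁺: rank M X = r∖e X and rank M′ X = r+e X ∸ r⁅e⁆.
module CStarTransformationProperties {n} (M M′ : Matroid n)
                                     (tr : CStarTransformation M M′) (M≢M′ : ¬ SameMatroid M M′) where
  M⁺ = proj₁ tr
  open RankProperties M⁺ using (mono; subadditive; rank-⁅x⁆≤1; rank-∪-absorb)
  open CircuitProperties M using (circuit-rank-minus)

  r∖e r+e : Subset n → ℕ
  r∖e X = rank M⁺ (outside ∷ X)
  r+e X = rank M⁺ (inside ∷ X)

  r⁅e⁆ : ℕ
  r⁅e⁆ = rank M⁺ ⁅ zero ⁆

  rank-M : ∀ X → rank M X ≡ r∖e X
  rank-M = proj₁ (proj₂ tr)

  r∖e≤r+e : ∀ X → r∖e X ≤ r+e X
  r∖e≤r+e X = mono (out⊆ ⊆-refl)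

  r+e≤r∖e+r⁅e⁆ : ∀ X → r+e X ≤ r∖e X + r⁅e⁆
  r+e≤r∖e+r⁅e⁆ X = subadditive (outside ∷ X) ⁅ zero ⁆ cover
    where
    cover : inside ∷ X ⊆ (outside ∷ X) ∪ ⁅ zero ⁆
    cover here       = here
    cover (there x∈) = there (p⊆p∪q ⊥ x∈)

  SameMatroid⁺ : (∀ X → r∖e X ≡ r+e X ∸ r⁅e⁆) → SameMatroid M M′
  SameMatroid⁺ r∖e≡ X = trans (rank-M X) (trans (r∖e≡ X) (sym (proj₂ (proj₂ tr) X)))

  r⁅e⁆≡1 : r⁅e⁆ ≡ 1
  r⁅e⁆≡1 = ≤-antisym (rank-⁅x⁆≤1 zero) (n≢0⇒n>0 (M≢M′ ∘ SameMatroid⁺ ∘ r∖e≡r+e))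
    where
    r∖e≡r+e : r⁅e⁆ ≡ 0 → ∀ X → r∖e X ≡ r+e X ∸ r⁅e⁆
    r∖e≡r+e r⁅e⁆≡0 X = trans
      (≤-antisym (r∖e≤r+e X) (≤-trans (r+e≤r∖e+r⁅e⁆ X) (≤-reflexive (trans (cong (r∖e X +_) r⁅e⁆≡0) (+-identityʳ _)))))
      (cong (r+e X ∸_) (sym r⁅e⁆≡0))

  rank-M′ : ∀ X → rank M′ X ≡ r+e X ∸ 1
  rank-M′ X = trans (proj₂ (proj₂ tr) X) (cong (r+e X ∸_) r⁅e⁆≡1)

  r+e⊤≡r∖e⊤ : r+e ⊤ ≡ r∖e ⊤
  r+e⊤≡r∖e⊤ = ≤-antisym (≤-pred (≤∧≢⇒< r+e⊤≤1+r∖e⊤ (M≢M′ ∘ SameMatroid⁺ ∘ r∖e≡r+e∸1))) (r∖e≤r+e ⊤)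
    where
    r+e≤1+r∖e : ∀ X → r+e X ≤ suc (r∖e X)
    r+e≤1+r∖e X = ≤-trans (r+e≤r∖e+r⁅e⁆ X) (≤-reflexive (trans (cong (r∖e X +_) r⁅e⁆≡1) (+-comm _ 1)))
    r+e⊤≤1+r∖e⊤ = r+e≤1+r∖e ⊤
    -- Submodularity on E ∖ e and X + e: were e a coloop of M⁺, it would be a
    -- coloop of every X + e.
    r∖e≡r+e∸1 : r+e ⊤ ≡ suc (r∖e ⊤) → ∀ X → r∖e X ≡ r+e X ∸ r⁅e⁆
    r∖e≡r+e∸1 e-coloop X = trans (cong (_∸ 1) (sym (≤-antisym (r+e≤1+r∖e X) 1+r∖e≤r+e))) (cong (r+e X ∸_) (sym r⁅e⁆≡1))
      where
      open ≤-Reasoning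
      1+r∖e≤r+e : suc (r∖e X) ≤ r+e X
      1+r∖e≤r+e = +-cancelˡ-≤ (r∖e ⊤) _ _ (begin
        r∖e ⊤ + suc (r∖e X)                       ≡⟨ +-suc _ _ ⟩
        suc (r∖e ⊤) + r∖e X                       ≡⟨ cong (_+ r∖e X) (sym e-coloop) ⟩
        r+e ⊤ + r∖e X                             ≤⟨ +-mono-≤ (mono (in⊆in (p⊆p∪q X)))
                                                              (mono (out⊆ (λ x∈ → x∈p∩q⁺ (∈⊤ , x∈)))) ⟩
        rank M⁺ (inside ∷ (⊤ ∪ X)) + rank M⁺ (outside ∷ (⊤ ∩ X)) ≤⟨ rank-sub M⁺ (outside ∷ ⊤) (inside ∷ X) ⟩
        r∖e ⊤ + r+e X                             ∎)

  rank⊤≡1+rank′⊤ : rank M ⊤ ≡ suc (rank M′ ⊤)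
  rank⊤≡1+rank′⊤ = begin
    rank M ⊤            ≡⟨ rank-M ⊤ ⟩
    r∖e ⊤               ≡⟨ sym r+e⊤≡r∖e⊤ ⟩
    r+e ⊤               ≡⟨ sym (m+[n∸m]≡n 1≤r+e⊤) ⟩
    suc (r+e ⊤ ∸ 1)     ≡⟨ cong suc (sym (rank-M′ ⊤)) ⟩
    suc (rank M′ ⊤)     ∎
    where
    open ≡-Reasoning
    1≤r+e⊤ : 1 ≤ r+e ⊤
    1≤r+e⊤ = ≤-trans (≤-reflexive (sym r⁅e⁆≡1)) (mono (s⊆s ⊆⊤))

  rank≤1+rank′ : ∀ X → rank M X ≤ suc (rank M′ X)
  rank≤1+rank′ X = begin
    rank M X           ≡⟨ rank-M X ⟩
    r∖e X              ≤⟨ r∖e≤r+e X ⟩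
    r+e X              ≤⟨ m≤n+m∸n (r+e X) 1 ⟩
    suc (r+e X ∸ 1)    ≡⟨ cong suc (sym (rank-M′ X)) ⟩
    suc (rank M′ X)    ∎
    where open ≤-Reasoning

  -- C ∖ x spans x in M = M⁺ ∖ e, so ⊤ ∖ x together with e spans x in M⁺.
  circuit⇒nonColoop′ : ∀ {C x} → Circuit M C → x ∈ C → ¬ Coloop M′ x
  circuit⇒nonColoop′ {C} {x} C-circ x∈C x-coloop = <⇒≱ x-coloop (begin
    rank M′ ⊤           ≡⟨ rank-M′ ⊤ ⟩
    r+e ⊤ ∸ 1           ≤⟨ ∸-monoˡ-≤ 1 r+e⊤≤ ⟩
    r+e (⊤ - x) ∸ 1     ≡⟨ sym (rank-M′ (⊤ - x)) ⟩
    rank M′ (⊤ - x)     ∎)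
    where
    open ≤-Reasoning
    r+e⊤≤ : r+e ⊤ ≤ r+e (⊤ - x)
    r+e⊤≤ = ≤-trans (mono (in⊆in (λ _ → p⊆p-x∪q ⊤ x∈C ∈⊤))) (rank-∪-absorb (inside ∷ (⊤ - x)) (outside ∷ C) (begin
      rank M⁺ (outside ∷ C)            ≡⟨ sym (rank-M C) ⟩
      rank M C                         ≤⟨ circuit-rank-minus C-circ x∈C ⟩
      rank M (C - x)                   ≤⟨ rank-mono M _ _ (λ y∈ → x∈p∩q⁺ (x∈p∧x≢y⇒x∈p-y ∈⊤ (proj₂ (x∈p-y⁻ C x y∈)) , p-x⊆p C x y∈)) ⟩
      rank M ((⊤ - x) ∩ C)             ≡⟨ rank-M _ ⟩
      rank M⁺ (outside ∷ ((⊤ - x) ∩ C)) ∎))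

  nonLoopNonColoop⊎AllLoops′ : (∀ x → ∃ λ C → Circuit M C × x ∈ C) → NonLoopNonColoop⊎AllLoops M′
  nonLoopNonColoop⊎AllLoops′ in-circuit with any? (λ x → ¬? (rank M′ ⁅ x ⁆ ≟ 0))
  ... | yes (x , nonLoop) = let (C , C-circ , x∈C) = in-circuit x in inj₁ (x , nonLoop , circuit⇒nonColoop′ C-circ x∈C)
  ... | no none           = inj₂ λ x → decidable-stable (rank M′ ⁅ x ⁆ ≟ 0) (λ nonLoop → none (x , nonLoop))

-- From c*-depth to contraction*-depth

CStarDepthAtMost⇒1≤ : ∀ {M : Matroid n} {m} → CStarDepthAtMost M m → 1 ≤ m
CStarDepthAtMost⇒1≤ (small _ _ 1≤m)                  = 1≤m
CStarDepthAtMost⇒1≤ (connected _ _ _ _ _ _ _)         = s≤s z≤n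
CStarDepthAtMost⇒1≤ (disconnected M (s≤s (s≤s _)) _ components) = CStarDepthAtMost⇒1≤
  (components K (component-isComponent zero) _ (restriction M K) (embed K) (restriction-isRestriction M K))
  where
  open ComponentProperties M
  K = component zero

SharedCircuit⇒2≤ : ∀ {M : Matroid n} {m} → CStarDepthAtMost M m → ∀ {x y} → SharedCircuit M x y → x ≢ y → 2 ≤ m
SharedCircuit⇒2≤ (small _ n≤1 _) {x} {y} _ x≢y = contradiction (Fin≤1-unique n≤1 x y) x≢y
SharedCircuit⇒2≤ (connected _ _ _ _ _ _ D′) _ _ = s≤s (CStarDepthAtMost⇒1≤ D′)
SharedCircuit⇒2≤ (disconnected M _ _ components) {x} xy x≢y with ComponentProperties.SharedCircuit-component M xy x≢y
... | i , j , i≢j , ij = SharedCircuit⇒2≤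
  (components K (ComponentProperties.component-isComponent M x) _ (restriction M K) (embed K) (restriction-isRestriction M K)) ij i≢j
  where K = ComponentProperties.component M x

small⇒rank⊤≡0 : ∀ (M : Matroid n) → n ≤ 1 → NonLoopNonColoop⊎AllLoops M → rank M ⊤ ≡ 0
small⇒rank⊤≡0 {zero}        M _        _                             = RankProperties.rank-Empty M λ { (() , _) }
small⇒rank⊤≡0 {suc zero}    M _        (inj₂ all-loops)              = all-loops zero
small⇒rank⊤≡0 {suc zero}    M _        (inj₁ (zero , _ , nonColoop)) =
  n≤0⇒n≡0 (≤-trans (≮⇒≥ nonColoop) (rank-≤ M (⊤ - zero)))
small⇒rank⊤≡0 {suc (suc _)} M (s≤s ()) _

CStarDepthAtMost⇒decomposition : ∀ {M : Matroid n} {d} → NonLoopNonColoop⊎AllLoops M → CStarDepthAtMost M d →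
                                 HasDecompositionOfHeight M d
CStarDepthAtMost⇒decomposition {M = M} hyp (small _ n≤1 1≤d) =
  PartialDecomposition-⊤ M (trivialDecomposition M (small⇒rank⊤≡0 M n≤1 hyp) 1≤d)
CStarDepthAtMost⇒decomposition hyp (connected M 2≤n M-connected M′ tr M≢M′ D′) =
  rootExtensionDecomposition M M′ (CStarDepthAtMost⇒decomposition hyp′ D′) rank⊤≡1+rank′⊤ rank≤1+rank′
  where
  open CStarTransformationProperties M M′ tr M≢M′
  hyp′ : NonLoopNonColoop⊎AllLoops M′
  hyp′ = nonLoopNonColoop⊎AllLoops′ (ComponentProperties.connected⇒in-circuit M 2≤n M-connected)
CStarDepthAtMost⇒decomposition hyp D@(disconnected {m = m} M _ _ components) =
  componentsDecomposition M (CStarDepthAtMost⇒1≤ D) decompose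
  where
  open RankProperties M
  open ComponentProperties M
  singletonDecomposition : ∀ x → component x ⊆ ⁅ x ⁆ → PartialDecomposition M (component x) m
  singletonDecomposition x K⊆⁅x⁆ with rank M (component x) ≟ 0
  ... | yes rank≡0 = trivialDecomposition M rank≡0 (CStarDepthAtMost⇒1≤ D)
  ... | no rank≢0  = singleEdgeDecomposition M rank≡1 (2≤m hyp)
    where
    rank≡1 : rank M (component x) ≡ 1
    rank≡1 = ≤-antisym (≤-trans (mono K⊆⁅x⁆) (rank-⁅x⁆≤1 x)) (n≢0⇒n>0 rank≢0)
    2≤m : NonLoopNonColoop⊎AllLoops M → 2 ≤ m
    2≤m (inj₁ (z , nonLoop , nonColoop)) =
      let (w , w≢z , zw) = nonLoop-nonColoop⇒SharedCircuit nonLoop nonColoop in SharedCircuit⇒2≤ D zw (w≢z ∘ sym)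
    2≤m (inj₂ all-loops) = contradiction (n≤0⇒n≡0 (≤-trans (mono K⊆⁅x⁆) (≤-reflexive (all-loops x)))) rank≢0
  decompose : ∀ x → PartialDecomposition M (component x) m
  decompose x with other-or-⊆⁅x⁆ (component x) x
  ... | inj₂ K⊆⁅x⁆ = singletonDecomposition x K⊆⁅x⁆
  ... | inj₁ (y , y∈K , y≢x) with SharedCircuit-component (∼⇒SharedCircuit (∈component⁻ y∈K) (y≢x ∘ sym)) (y≢x ∘ sym)
  ...   | i , j , i≢j , ij = restrictionDecomposition M (component x) (CStarDepthAtMost⇒decomposition
          (inj₁ (i , ComponentProperties.SharedCircuit⇒nonLoop-nonColoop (restriction M (component x)) ij i≢j))
          (components (component x) (component-isComponent x) _ (restriction M (component x)) (embed (component x))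
                      (restriction-isRestriction M (component x))))

mainTheorem13 : ∀ {n} (M : Matroid n) →
    ((∃ λ (x : Fin n) → ¬ Loop M x × ¬ Coloop M x) ⊎ (∀ (x : Fin n) → Loop M x)) →
    ∀ (d : ℕ) → CStarDepthAtMost M d → ContractionStarDepthAtMost M (d ∸ 1)
mainTheorem13 M hyp d D with CStarDepthAtMost⇒decomposition hyp D
... | decomposition , height = decomposition , λ v v-leaf → ≤-trans (height v v-leaf) (m≤n+m∸n d 1)
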